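{- Let $N$ be a positive integer all of whose prime factors are congruent to $1$ modulo $4$, and let $N^*$ be the greatest square dividing $N$. Then \[\mathcal{N}_2(N)-|\mathcal{P}_2|N^2=\frac13+2\sqrt{N^*}.\]
   Context: $\mathcal{P}_2=\{(x,y)\in\mathbb{R}^2 : |y|\le 1-x^2\}$, with area $|\mathcal{P}_2|=8/3$, and for $R>0$, $\mathcal{N}_2(R)=\#\{\vec{n}\in\mathbb{Z}^2 : R^{ -1}\vec{n}\in\mathcal{P}_2\}$. -}

module Defs where

open import Data.Nat as ℕ using (ℕ; NonZero)
open import Data.Nat.Divisibility using (_∣_)
open import Data.Integer as ℤ using (ℤ; +_)
open import Data.Rational as ℚ using (ℚ; _/_; ∣_∣; 1ℚ)
open import Data.Rational.Properties using (_≤?_)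
open import Data.List using (List; map; upTo; filter; length; cartesianProduct)
open import Data.Product using (_×_; _,_; proj₁; proj₂; ∃-syntax)
open import Relation.Binary.PropositionalEquality using (_≡_)

ι : ℕ → ℚ
ι n = + n / 1

InP₂ : ℚ × ℚ → Set
InP₂ (x , y) = ∣ y ∣ ℚ.≤ 1ℚ ℚ.- x ℚ.* x

symRange : ℕ → List ℤ
symRange N = map (λ i → + i ℤ.- + N) (upTo (2 ℕ.* N ℕ.+ 1))

scale : (R : ℕ) .{{_ : NonZero R}} → ℤ × ℤ → ℚ × ℚ
scale R (a , b) = (a / R , b / R)

-- 𝒩₂(R) = #{n ∈ ℤ² : R⁻¹ n ∈ P₂}, for a positive integer R.
-- Since P₂ ⊆ [-1,1]², all such n lie in the box [-R,R]², which we enumerate.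
𝒩₂ : (R : ℕ) .{{_ : NonZero R}} → ℕ
𝒩₂ R = length (filter (λ n → InP₂-dec (scale R n)) (cartesianProduct (symRange R) (symRange R)))
  where
  InP₂-dec : (p : ℚ × ℚ) → _
  InP₂-dec (x , y) = ∣ y ∣ ≤? (1ℚ ℚ.- x ℚ.* x)

areaP₂ : ℚ
areaP₂ = + 8 / 3

IsGreatestSquareDivisor : ℕ → ℕ → Set
IsGreatestSquareDivisor N M =
  (∃[ s ] M ≡ s ℕ.* s) × (M ∣ N) × (∀ k → (k ℕ.* k) ∣ N → k ℕ.* k ℕ.≤ M)

-- Sorting the lattice points of N·P₂ by their first coordinate x gives
-- 𝒩₂(N) = 1 + 4N + 4 Σ_{x=1}^{N} ⌊(N² − x²)/N⌋.  Dividing N² − x² by N and summing over x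
-- reduces this floor sum to Σ x² and to the sum of the residues r(x) of −x² modulo N.
-- As every prime factor of N is 1 mod 4, −1 is a square i² modulo N: for a prime p = 4k + 1,
-- sending x ∈ [1, 2k] to the y ∈ [1, 2k] with xy ≡ ±1 is an involution fixing 1, so it has a
-- second fixed point, whose square is −1; Hensel lifting and the Chinese remainder theorem
-- pass from primes to N.  Multiplication by i permutes the residues and turns x² into −x², so
-- Σ r(x) = Σ (x² mod N).  Since r(x) + (x² mod N) = N unless N ∣ x², and N ∣ x² for exactly
-- √N* of the x < N, this gives 2 Σ r(x) = N² − N√N*, and hence 3𝒩₂(N) = 8N² + 1 + 6√N*.

module Submission where

open import Defs

import Algebra.Properties.CommutativeMonoid.Sum as MonoidSum
open import Data.Bool using (true; false; if_then_else_)
open import Data.Empty using (⊥-elim)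
open import Data.Fin using (Fin; toℕ; fromℕ<)
open import Data.Fin.Permutation using (Permutation; permutation)
open import Data.Fin.Properties using (toℕ-fromℕ<; toℕ<n; toℕ-injective)
open import Data.Integer as ℤ using (ℤ)
import Data.Integer.Properties as ℤ
open import Data.Integer.Tactic.RingSolver using () renaming (solve to ℤ-solve; solve-∀ to ℤ-solve-∀)
open import Data.List using (List; []; _∷_; _++_; map; filter; length; applyUpTo; upTo; cartesianProduct)
open import Data.List.Properties using (map-++; map-cong; map-∘)
open import Data.List.Relation.Unary.All using (All)
import Data.List.Relation.Unary.All as All
open import Data.Nat as ℕ hiding (_/_)
open import Data.Nat.Coprimality using (Coprime; coprime-Bézout; coprime-divisor; coprime-factors; coprime-/gcd) renaming (sym to ⊥-sym)
open import Data.Nat.DivMod hiding (_/_)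
open import Data.Nat.Divisibility
open import Data.Nat.GCD using (gcd; gcd[m,n]∣m; gcd[m,n]∣n; gcd[m,n]≢0; gcd[m,n]≤n; module Bézout)
open import Data.Nat.Induction using (<-rec)
open import Data.Nat.ListAction using (sum; product)
open import Data.Nat.ListAction.Properties using (sum-++)
open import Data.Nat.Primality using (Prime; prime⇒nonZero; prime⇒irreducible; euclidsLemma; ¬prime[1]; productOfPrimes≢0)
open import Data.Nat.Primality.Factorisation using (factorise; PrimeFactorisation)
open import Data.Nat.Properties
open import Algebra.Properties.CommutativeSemigroup +-commutativeSemigroup using () renaming (interchange to +-interchange)
open import Data.Nat.Tactic.RingSolver using (solve; solve-∀)
open import Data.Product using (_×_; _,_; ∃; proj₁; proj₂)
open import Data.Rational as ℚ using (ℚ; toℚᵘ)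
import Data.Rational.Properties as ℚ
open import Data.Rational.Properties
  using (toℚᵘ-injective; toℚᵘ-mono-≤; toℚᵘ-cancel-≤; toℚᵘ-fromℚᵘ;
         toℚᵘ-homo-∣-∣; toℚᵘ-homo-+; toℚᵘ-homo‿-; toℚᵘ-homo-*)
import Data.Rational.Unnormalised as ℚᵘ
import Data.Rational.Unnormalised.Properties as ℚᵘ
open import Data.Sign.Properties using (s*s≡+)
open import Data.Sum using (_⊎_; inj₁; inj₂)
open import Function using (_∘_)
open import Function.Bundles using (_⇔_; mk⇔; Equivalence)
open import Function.Properties.Equivalence using () renaming (trans to ⇔-trans)
open import Relation.Binary.Definitions using (tri<; tri≈; tri>)
open import Relation.Binary.PropositionalEquality
open import Relation.Nullary using (Dec; yes; no; does; ¬_; contradiction; _×-dec_)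
open import Relation.Unary using (Pred; Decidable)

∑< : ℕ → (ℕ → ℕ) → ℕ
∑< zero    f = 0
∑< (suc n) f = ∑< n f + f n

syntax ∑< n (λ i → e) = ∑[ i < n ] e

module _ {f g : ℕ → ℕ} where

  ∑<-cong : ∀ n → (∀ i → i < n → f i ≡ g i) → ∑< n f ≡ ∑< n g
  ∑<-cong zero    f≡g = refl
  ∑<-cong (suc n) f≡g = cong₂ _+_ (∑<-cong n (λ i i<n → f≡g i (m<n⇒m<1+n i<n))) (f≡g n ≤-refl)

  ∑<-distrib-+ : ∀ n → ∑[ i < n ] (f i + g i) ≡ ∑< n f + ∑< n g
  ∑<-distrib-+ zero    = refl
  ∑<-distrib-+ (suc n) = begin
    ∑[ i < n ] (f i + g i) + (f n + g n) ≡⟨ cong (_+ (f n + g n)) (∑<-distrib-+ n) ⟩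
    ∑< n f + ∑< n g + (f n + g n)        ≡⟨ +-interchange (∑< n f) (∑< n g) (f n) (g n) ⟩
    ∑< n f + f n + (∑< n g + g n)        ∎
    where open ≡-Reasoning

∑<-sucˡ : ∀ n (f : ℕ → ℕ) → ∑< (suc n) f ≡ f 0 + ∑< n (f ∘ suc)
∑<-sucˡ zero    f = +-comm 0 (f 0)
∑<-sucˡ (suc n) f = trans (cong (_+ f (suc n)) (∑<-sucˡ n f)) (+-assoc (f 0) _ _)

∑<-*ˡ : ∀ n c (f : ℕ → ℕ) → ∑[ i < n ] (c * f i) ≡ c * ∑< n f
∑<-*ˡ zero    c f = sym (*-zeroʳ c)
∑<-*ˡ (suc n) c f = trans (cong (_+ c * f n) (∑<-*ˡ n c f)) (sym (*-distribˡ-+ c (∑< n f) (f n)))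

∑<-const : ∀ n c → ∑[ i < n ] c ≡ n * c
∑<-const zero    c = refl
∑<-const (suc n) c = trans (cong (_+ c) (∑<-const n c)) (+-comm (n * c) c)

∑<-+ : ∀ m n (f : ℕ → ℕ) → ∑< (m + n) f ≡ ∑< m f + ∑[ i < n ] f (m + i)
∑<-+ m zero    f = trans (cong (λ k → ∑< k f) (+-identityʳ m)) (sym (+-identityʳ _))
∑<-+ m (suc n) f = begin
  ∑< (m + suc n) f                               ≡⟨ cong (λ k → ∑< k f) (+-suc m n) ⟩
  ∑< (m + n) f + f (m + n)                        ≡⟨ cong (_+ f (m + n)) (∑<-+ m n f) ⟩
  ∑< m f + ∑[ i < n ] f (m + i) + f (m + n)      ≡⟨ +-assoc (∑< m f) _ _ ⟩
  ∑< m f + (∑[ i < n ] f (m + i) + f (m + n))    ∎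
  where open ≡-Reasoning

∑<-reverse : ∀ n (f : ℕ → ℕ) → ∑[ i < n ] f (n ∸ i) ≡ ∑< n (f ∘ suc)
∑<-reverse zero    f = refl
∑<-reverse (suc n) f = begin
  ∑[ i < suc n ] f (suc n ∸ i)         ≡⟨ ∑<-sucˡ n (λ i → f (suc n ∸ i)) ⟩
  f (suc n) + ∑[ i < n ] f (n ∸ i)     ≡⟨ cong (f (suc n) +_) (∑<-reverse n f) ⟩
  f (suc n) + ∑< n (f ∘ suc)           ≡⟨ +-comm (f (suc n)) _ ⟩
  ∑< n (f ∘ suc) + f (suc n)           ∎
  where open ≡-Reasoning

∑<-rotate : ∀ n (f : ℕ → ℕ) → f 0 ≡ f n → ∑< n (f ∘ suc) ≡ ∑< n f
∑<-rotate n f f0≡fn = +-cancelˡ-≡ (f 0) _ _ (begin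
  f 0 + ∑< n (f ∘ suc)  ≡⟨ ∑<-sucˡ n f ⟨
  ∑< n f + f n          ≡⟨ cong (∑< n f +_) f0≡fn ⟨
  ∑< n f + f 0          ≡⟨ +-comm (∑< n f) (f 0) ⟩
  f 0 + ∑< n f          ∎)
  where open ≡-Reasoning

module _ where
  open MonoidSum +-0-commutativeMonoid using (sum-cong-≗; sum-permute) renaming (sum to ∑ᶠ)

  private
    ∑<≡∑ᶠ : ∀ n (f : ℕ → ℕ) → ∑< n f ≡ ∑ᶠ {n} (f ∘ toℕ)
    ∑<≡∑ᶠ zero    f = refl
    ∑<≡∑ᶠ (suc n) f = trans (∑<-sucˡ n f) (cong (f 0 +_) (∑<≡∑ᶠ n (f ∘ suc)))

  ∑<-permute : ∀ n (σ τ : ℕ → ℕ) →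
    (∀ i → i < n → σ i < n) → (∀ i → i < n → τ i < n) →
    (∀ i → i < n → τ (σ i) ≡ i) → (∀ i → i < n → σ (τ i) ≡ i) →
    ∀ f → ∑< n (f ∘ σ) ≡ ∑< n f
  ∑<-permute n σ τ σ< τ< τσ στ f = begin
    ∑< n (f ∘ σ)                 ≡⟨ ∑<≡∑ᶠ n (f ∘ σ) ⟩
    ∑ᶠ {n} (f ∘ σ ∘ toℕ)         ≡⟨ sum-cong-≗ {n} (λ i → cong f (sym (toℕ-fromℕ< (σ< (toℕ i) (toℕ<n i))))) ⟩
    ∑ᶠ {n} (f ∘ toℕ ∘ σᶠ)        ≡⟨ sym (sum-permute (f ∘ toℕ) π) ⟩
    ∑ᶠ {n} (f ∘ toℕ)             ≡⟨ sym (∑<≡∑ᶠ n f) ⟩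
    ∑< n f                       ∎
    where
    open ≡-Reasoning
    σᶠ τᶠ : Fin n → Fin n
    σᶠ i = fromℕ< (σ< (toℕ i) (toℕ<n i))
    τᶠ i = fromℕ< (τ< (toℕ i) (toℕ<n i))
    π : Permutation n n
    π = permutation σᶠ τᶠ
      (λ i → toℕ-injective (trans (toℕ-fromℕ< _) (trans (cong σ (toℕ-fromℕ< _)) (στ (toℕ i) (toℕ<n i)))))
      (λ i → toℕ-injective (trans (toℕ-fromℕ< _) (trans (cong τ (toℕ-fromℕ< _)) (τσ (toℕ i) (toℕ<n i)))))

-- Counting lattice points column by column

𝟙 : ∀ {p} {P : Set p} → Dec P → ℕ
𝟙 P? = if does P? then 1 else 0

module _ {p} {P : Set p} where

  𝟙-yes : (P? : Dec P) → P → 𝟙 P? ≡ 1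
  𝟙-yes (yes _) _  = refl
  𝟙-yes (no ¬p) p  = ⊥-elim (¬p p)

  𝟙-no : (P? : Dec P) → ¬ P → 𝟙 P? ≡ 0
  𝟙-no (no _)  _  = refl
  𝟙-no (yes p) ¬p = ⊥-elim (¬p p)

  𝟙-cong : ∀ {q} {Q : Set q} → P ⇔ Q → (P? : Dec P) (Q? : Dec Q) → 𝟙 P? ≡ 𝟙 Q?
  𝟙-cong P⇔Q P? (yes q) = 𝟙-yes P? (Equivalence.from P⇔Q q)
  𝟙-cong P⇔Q P? (no ¬q) = 𝟙-no P? (¬q ∘ Equivalence.to P⇔Q)

length-filter≡sum-𝟙 : ∀ {a p} {A : Set a} {P : Pred A p} (P? : Decidable P) (xs : List A) →
  length (filter P? xs) ≡ sum (map (𝟙 ∘ P?) xs)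
length-filter≡sum-𝟙 P? []       = refl
length-filter≡sum-𝟙 P? (x ∷ xs) with does (P? x)
... | true  = cong suc (length-filter≡sum-𝟙 P? xs)
... | false = length-filter≡sum-𝟙 P? xs

sum-map-applyUpTo : ∀ {a} {A : Set a} n (f : A → ℕ) (g : ℕ → A) → sum (map f (applyUpTo g n)) ≡ ∑< n (f ∘ g)
sum-map-applyUpTo zero    f g = refl
sum-map-applyUpTo (suc n) f g = trans (cong (f (g 0) +_) (sum-map-applyUpTo n f (g ∘ suc))) (sym (∑<-sucˡ n (f ∘ g)))

length-filter-cartesianProduct : ∀ {a b p} {A : Set a} {B : Set b} {P : Pred (A × B) p}
  (P? : Decidable P) (xs : List A) (ys : List B) →
  length (filter P? (cartesianProduct xs ys)) ≡ sum (map (λ x → sum (map (λ y → 𝟙 (P? (x , y))) ys)) xs)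
length-filter-cartesianProduct P? xs ys = trans (length-filter≡sum-𝟙 P? (cartesianProduct xs ys)) (rows xs)
  where
  rows : ∀ xs → sum (map (𝟙 ∘ P?) (cartesianProduct xs ys)) ≡ sum (map (λ x → sum (map (λ y → 𝟙 (P? (x , y))) ys)) xs)
  rows []       = refl
  rows (x ∷ xs) = begin
    sum (map (𝟙 ∘ P?) (map (x ,_) ys ++ cartesianProduct xs ys))
      ≡⟨ cong sum (map-++ (𝟙 ∘ P?) (map (x ,_) ys) _) ⟩
    sum (map (𝟙 ∘ P?) (map (x ,_) ys) ++ map (𝟙 ∘ P?) (cartesianProduct xs ys))
      ≡⟨ sum-++ (map (𝟙 ∘ P?) (map (x ,_) ys)) _ ⟩
    sum (map (𝟙 ∘ P?) (map (x ,_) ys)) + sum (map (𝟙 ∘ P?) (cartesianProduct xs ys))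
      ≡⟨ cong₂ _+_ (cong sum (sym (map-∘ ys))) (rows xs) ⟩
    sum (map (λ y → 𝟙 (P? (x , y))) ys) + sum (map (λ x → sum (map (λ y → 𝟙 (P? (x , y))) ys)) xs)
      ∎
    where open ≡-Reasoning

private
  ∣i-N∣ : ∀ {i N} → i ≤ N → ℤ.∣ ℤ.+ i ℤ.- ℤ.+ N ∣ ≡ N ∸ i
  ∣i-N∣ {i} {N} i≤N = trans (cong ℤ.∣_∣ (ℤ.m-n≡m⊖n i N)) (ℤ.∣⊖∣-≤ i≤N)

  ∣N+k-N∣ : ∀ N k → ℤ.∣ ℤ.+ (N + k) ℤ.- ℤ.+ N ∣ ≡ k
  ∣N+k-N∣ N k = begin
    ℤ.∣ ℤ.+ (N + k) ℤ.- ℤ.+ N ∣ ≡⟨ cong ℤ.∣_∣ (ℤ.m-n≡m⊖n (N + k) N) ⟩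
    ℤ.∣ (N + k) ℤ.⊖ N ∣ ≡⟨ ℤ.∣m⊖n∣≡∣n⊖m∣ (N + k) N ⟩
    ℤ.∣ N ℤ.⊖ (N + k) ∣ ≡⟨ ℤ.∣⊖∣-≤ (m≤m+n N k) ⟩
    N + k ∸ N           ≡⟨ m+n∸m≡n N k ⟩
    k                   ∎
    where open ≡-Reasoning

sum-symRange : ∀ N (g : ℕ → ℕ) → sum (map (g ∘ ℤ.∣_∣) (symRange N)) ≡ g 0 + 2 * ∑< N (g ∘ suc)
sum-symRange N g = begin
  sum (map (g ∘ ℤ.∣_∣) (symRange N))          ≡⟨ cong sum (sym (map-∘ (upTo (2 * N + 1)))) ⟩
  sum (map (g ∘ ℤ.∣_∣ ∘ shift) (upTo (2 * N + 1))) ≡⟨ sum-map-applyUpTo (2 * N + 1) (g ∘ ℤ.∣_∣ ∘ shift) (λ i → i) ⟩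
  ∑< (2 * N + 1) h                            ≡⟨ cong (λ k → ∑< k h) 2N+1≡N+[1+N] ⟩
  ∑< (N + suc N) h                            ≡⟨ ∑<-+ N (suc N) h ⟩
  ∑< N h + ∑[ k < suc N ] h (N + k)           ≡⟨ cong₂ _+_ (∑<-cong N (λ i i<N → cong g (∣i-N∣ (<⇒≤ i<N))))
                                                           (∑<-cong (suc N) (λ k _ → cong g (∣N+k-N∣ N k))) ⟩
  ∑[ i < N ] g (N ∸ i) + ∑< (suc N) g        ≡⟨ cong₂ _+_ (∑<-reverse N g) (∑<-sucˡ N g) ⟩
  ∑< N (g ∘ suc) + (g 0 + ∑< N (g ∘ suc))    ≡⟨ regroup (∑< N (g ∘ suc)) (g 0) ⟩
  g 0 + 2 * ∑< N (g ∘ suc)                   ∎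
  where
  open ≡-Reasoning
  shift : ℕ → ℤ
  shift i = ℤ.+ i ℤ.- ℤ.+ N
  h : ℕ → ℕ
  h = g ∘ ℤ.∣_∣ ∘ shift
  regroup : ∀ s g₀ → s + (g₀ + s) ≡ g₀ + 2 * s
  regroup = solve-∀
  2N+1≡N+[1+N] : 2 * N + 1 ≡ N + suc N
  2N+1≡N+[1+N] = solve (N ∷ [])

private
  ≤-clearDenominator⇔ : ∀ m .{{_ : ℤ.Positive m}} .{{_ : ℤ.NonNegative m}} B A →
    (B ℤ.* (m ℤ.* m) ℤ.≤ (m ℤ.* m ℤ.- A) ℤ.* m) ⇔ (m ℤ.* B ℤ.+ A ℤ.≤ m ℤ.* m)
  ≤-clearDenominator⇔ m B A = mk⇔
    (λ h → ℤ.*-cancelʳ-≤-pos _ _ m (begin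
      (m ℤ.* B ℤ.+ A) ℤ.* m             ≡⟨ ℤ-solve (B ∷ A ∷ m ∷ []) ⟩
      B ℤ.* (m ℤ.* m) ℤ.+ A ℤ.* m       ≤⟨ ℤ.+-monoˡ-≤ (A ℤ.* m) h ⟩
      (m ℤ.* m ℤ.- A) ℤ.* m ℤ.+ A ℤ.* m ≡⟨ ℤ-solve (A ∷ m ∷ []) ⟩
      m ℤ.* m ℤ.* m                     ∎))
    (λ h → begin
      B ℤ.* (m ℤ.* m)                   ≡⟨ ℤ-solve (B ∷ A ∷ m ∷ []) ⟩
      (m ℤ.* B ℤ.+ A) ℤ.* m ℤ.- A ℤ.* m ≤⟨ ℤ.+-monoˡ-≤ (ℤ.- (A ℤ.* m)) (ℤ.*-monoʳ-≤-nonNeg m h) ⟩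
      m ℤ.* m ℤ.* m ℤ.- A ℤ.* m         ≡⟨ ℤ-solve (A ∷ m ∷ []) ⟩
      (m ℤ.* m ℤ.- A) ℤ.* m             ∎)
    where open ℤ.≤-Reasoning

  toℚᵘ-InP₂⇔ : ∀ k a b → let n = suc k in
    InP₂ (scale n (a , b)) ⇔ (ℤ.+ ℤ.∣ b ∣ ℚᵘ./ n ℚᵘ.≤ ℚᵘ.1ℚᵘ ℚᵘ.- (a ℚᵘ./ n) ℚᵘ.* (a ℚᵘ./ n))
  toℚᵘ-InP₂⇔ k a b = mk⇔ (ℚᵘ.≤-respʳ-≃ 1-x²≃ ∘ ℚᵘ.≤-respˡ-≃ ∣y∣≃ ∘ toℚᵘ-mono-≤)
                         (toℚᵘ-cancel-≤ ∘ ℚᵘ.≤-respʳ-≃ (ℚᵘ.≃-sym 1-x²≃) ∘ ℚᵘ.≤-respˡ-≃ (ℚᵘ.≃-sym ∣y∣≃))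
    where
    n = suc k
    x x² : ℚ
    x  = a ℚ./ n
    x² = x ℚ.* x
    ∣y∣≃ : toℚᵘ ℚ.∣ b ℚ./ n ∣ ℚᵘ.≃ ℤ.+ ℤ.∣ b ∣ ℚᵘ./ n
    ∣y∣≃ = ℚᵘ.≃-trans (toℚᵘ-homo-∣-∣ (b ℚ./ n)) (ℚᵘ.∣-∣-cong (toℚᵘ-fromℚᵘ (b ℚᵘ./ n)))
    1-x²≃ : toℚᵘ (ℚ.1ℚ ℚ.- x²) ℚᵘ.≃ ℚᵘ.1ℚᵘ ℚᵘ.- (a ℚᵘ./ n) ℚᵘ.* (a ℚᵘ./ n)
    1-x²≃ = ℚᵘ.≃-trans (toℚᵘ-homo-+ ℚ.1ℚ (ℚ.- x²)) (ℚᵘ.+-congʳ ℚᵘ.1ℚᵘ (ℚᵘ.≃-trans (toℚᵘ-homo‿- x²)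
              (ℚᵘ.-‿cong (ℚᵘ.≃-trans (toℚᵘ-homo-* x x)
                (ℚᵘ.*-cong (toℚᵘ-fromℚᵘ (a ℚᵘ./ n)) (toℚᵘ-fromℚᵘ (a ℚᵘ./ n)))))))

inP₂-scale⇔ : ∀ n .{{_ : NonZero n}} a b →
  InP₂ (scale n (a , b)) ⇔ (n * ℤ.∣ b ∣ + ℤ.∣ a ∣ * ℤ.∣ a ∣ ≤ n * n)
inP₂-scale⇔ n@(suc k) a b =
  ⇔-trans (toℚᵘ-InP₂⇔ k a b) (⇔-trans unfold (⇔-trans (≤-clearDenominator⇔ m (ℤ.+ ℤ.∣ b ∣) (a ℤ.* a)) cast))
  where
  m = ℤ.+ n
  m*m≡ : m ℤ.* m ≡ ℤ.+ (n * n)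
  m*m≡ = sym (ℤ.pos-* n n)
  unfold : (ℤ.+ ℤ.∣ b ∣ ℚᵘ./ n ℚᵘ.≤ ℚᵘ.1ℚᵘ ℚᵘ.- (a ℚᵘ./ n) ℚᵘ.* (a ℚᵘ./ n))
         ⇔ (ℤ.+ ℤ.∣ b ∣ ℤ.* (m ℤ.* m) ℤ.≤ (m ℤ.* m ℤ.- a ℤ.* a) ℤ.* m)
  unfold = mk⇔ (λ { (ℚᵘ.*≤* q) → subst₂ ℤ._≤_ lhs≡ rhs≡ q })
               (λ q → ℚᵘ.*≤* (subst₂ ℤ._≤_ (sym lhs≡) (sym rhs≡) q))
    where
    lhs≡ : ℤ.+ ℤ.∣ b ∣ ℤ.* ℤ.+ (1 * (n * n)) ≡ ℤ.+ ℤ.∣ b ∣ ℤ.* (m ℤ.* m)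
    lhs≡ = cong (ℤ.+ ℤ.∣ b ∣ ℤ.*_) (trans (cong ℤ.+_ (*-identityˡ (n * n))) (sym m*m≡))
    rhs≡ : (ℤ.+ 1 ℤ.* ℤ.+ (n * n) ℤ.+ ℤ.- (a ℤ.* a) ℤ.* ℤ.+ 1) ℤ.* m ≡ (m ℤ.* m ℤ.- a ℤ.* a) ℤ.* m
    rhs≡ = trans (cong (λ X → (ℤ.+ 1 ℤ.* X ℤ.+ ℤ.- (a ℤ.* a) ℤ.* ℤ.+ 1) ℤ.* m) (sym m*m≡)) (tidy (a ℤ.* a) m)
      where
      tidy : ∀ A m → (ℤ.+ 1 ℤ.* (m ℤ.* m) ℤ.+ ℤ.- A ℤ.* ℤ.+ 1) ℤ.* m ≡ (m ℤ.* m ℤ.- A) ℤ.* m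
      tidy = ℤ-solve-∀
  cast : (m ℤ.* ℤ.+ ℤ.∣ b ∣ ℤ.+ a ℤ.* a ℤ.≤ m ℤ.* m) ⇔ (n * ℤ.∣ b ∣ + ℤ.∣ a ∣ * ℤ.∣ a ∣ ≤ n * n)
  cast = mk⇔ (λ h → ℤ.drop‿+≤+ (subst₂ ℤ._≤_ (sym sum≡) m*m≡ h))
             (λ h → subst₂ ℤ._≤_ sum≡ (sym m*m≡) (ℤ.+≤+ h))
    where
    a²≡ : a ℤ.* a ≡ ℤ.+ (ℤ.∣ a ∣ * ℤ.∣ a ∣)
    a²≡ = trans (cong (ℤ._◃ (ℤ.∣ a ∣ * ℤ.∣ a ∣)) (s*s≡+ (ℤ.sign a))) (ℤ.+◃n≡+n _)
    sum≡ : ℤ.+ (n * ℤ.∣ b ∣ + ℤ.∣ a ∣ * ℤ.∣ a ∣) ≡ m ℤ.* ℤ.+ ℤ.∣ b ∣ ℤ.+ a ℤ.* a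
    sum≡ = trans (ℤ.pos-+ (n * ℤ.∣ b ∣) _) (cong₂ ℤ._+_ (ℤ.pos-* n ℤ.∣ b ∣) (sym a²≡))

module _ (N : ℕ) .{{_ : NonZero N}} where

  private
    *≤⇒≤/ : ∀ {k d} → N * k ≤ d → k ≤ d ℕ./ N
    *≤⇒≤/ {k} {d} h = subst (_≤ d ℕ./ N) (trans (cong (ℕ._/ N) (*-comm N k)) (m*n/n≡m k N)) (/-monoˡ-≤ N h)

    ≤/⇒*≤ : ∀ {k d} → k ≤ d ℕ./ N → N * k ≤ d
    ≤/⇒*≤ {k} {d} h = ≤-trans (*-monoʳ-≤ N h) (subst (_≤ d) (*-comm (d ℕ./ N) N) (m/n*n≤m d N))

  ∑<-𝟙-multiple≤ : ∀ d K → ∑[ j < K ] 𝟙 (N * suc j ≤? d) ≡ K ⊓ (d ℕ./ N)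
  ∑<-𝟙-multiple≤ d zero    = refl
  ∑<-𝟙-multiple≤ d (suc K) with suc K ≤? d ℕ./ N
  ... | yes K<d/N = begin
    ∑[ j < K ] 𝟙 (N * suc j ≤? d) + 𝟙 (N * suc K ≤? d)
      ≡⟨ cong₂ _+_ (∑<-𝟙-multiple≤ d K) (𝟙-yes (N * suc K ≤? d) (≤/⇒*≤ K<d/N)) ⟩
    K ⊓ (d ℕ./ N) + 1                                     ≡⟨ cong (_+ 1) (m≤n⇒m⊓n≡m (<⇒≤ K<d/N)) ⟩
    K + 1                                               ≡⟨ +-comm K 1 ⟩
    suc K                                               ≡⟨ m≤n⇒m⊓n≡m K<d/N ⟨
    suc K ⊓ (d ℕ./ N)                                     ∎
    where open ≡-Reasoning
  ... | no K≮d/N = begin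
    ∑[ j < K ] 𝟙 (N * suc j ≤? d) + 𝟙 (N * suc K ≤? d)
      ≡⟨ cong₂ _+_ (∑<-𝟙-multiple≤ d K) (𝟙-no (N * suc K ≤? d) (K≮d/N ∘ *≤⇒≤/)) ⟩
    K ⊓ (d ℕ./ N) + 0                                     ≡⟨ +-identityʳ _ ⟩
    K ⊓ (d ℕ./ N)                                         ≡⟨ m≥n⇒m⊓n≡n d/N≤K ⟩
    d ℕ./ N                                               ≡⟨ m≥n⇒m⊓n≡n (m≤n⇒m≤1+n d/N≤K) ⟨
    suc K ⊓ (d ℕ./ N)                                     ∎
    where
    open ≡-Reasoning
    d/N≤K : d ℕ./ N ≤ K
    d/N≤K = s≤s⁻¹ (≰⇒> K≮d/N)

  inNP₂ : ℕ → ℕ → ℕ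
  inNP₂ x k = 𝟙 (N * k + x * x ≤? N * N)

  columnSize : ℕ → ℕ
  columnSize x = inNP₂ x 0 + 2 * ∑< N (inNP₂ x ∘ suc)

  columnSize≡ : ∀ x → x ≤ N → columnSize x ≡ 1 + 2 * ((N * N ∸ x * x) ℕ./ N)
  columnSize≡ x x≤N = cong₂ (λ u v → u + 2 * v) (𝟙-yes (N * 0 + x * x ≤? N * N) N*0+x²≤N²) (begin
    ∑< N (inNP₂ x ∘ suc)
      ≡⟨ ∑<-cong N (λ j _ → 𝟙-cong (move j) (N * suc j + x * x ≤? N * N) (N * suc j ≤? d)) ⟩
    ∑[ j < N ] 𝟙 (N * suc j ≤? d)
      ≡⟨ ∑<-𝟙-multiple≤ d N ⟩
    N ⊓ (d ℕ./ N)
      ≡⟨ m≥n⇒m⊓n≡n d/N≤N ⟩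
    d ℕ./ N
      ∎)
    where
    open ≡-Reasoning
    d = N * N ∸ x * x
    x²≤N² : x * x ≤ N * N
    x²≤N² = *-mono-≤ x≤N x≤N
    N*0+x²≤N² : N * 0 + x * x ≤ N * N
    N*0+x²≤N² = subst (λ z → z + x * x ≤ N * N) (sym (*-zeroʳ N)) x²≤N²
    move : ∀ j → (N * suc j + x * x ≤ N * N) ⇔ (N * suc j ≤ d)
    move j = mk⇔ (m+n≤o⇒m≤o∸n (N * suc j)) (m≤o∸n⇒m+n≤o (N * suc j) x²≤N²)
    d/N≤N : d ℕ./ N ≤ N
    d/N≤N = subst (d ℕ./ N ≤_) (m*n/n≡m N N) (/-monoˡ-≤ N (m∸n≤m (N * N) (x * x)))

  𝒩₂-floorSum : 𝒩₂ N ≡ 1 + 4 * N + 4 * ∑[ x < N ] ((N * N ∸ suc x * suc x) ℕ./ N)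
  𝒩₂-floorSum = begin
    𝒩₂ N
      ≡⟨ length-filter-cartesianProduct _ (symRange N) (symRange N) ⟩
    sum (map (λ a → sum (map (λ b → 𝟙 (InP₂? a b)) (symRange N))) (symRange N))
      ≡⟨ cong sum (map-cong column (symRange N)) ⟩
    sum (map (columnSize ∘ ℤ.∣_∣) (symRange N))
      ≡⟨ sum-symRange N columnSize ⟩
    columnSize 0 + 2 * ∑< N (columnSize ∘ suc)
      ≡⟨ cong₂ (λ u v → u + 2 * v) centre sides ⟩
    1 + 2 * N + 2 * (N + 2 * ∑< N F)
      ≡⟨ regroup N (∑< N F) ⟩
    1 + 4 * N + 4 * ∑< N F
      ∎
    where
    open ≡-Reasoning
    F : ℕ → ℕ
    F x = (N * N ∸ suc x * suc x) ℕ./ N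
    InP₂? : ∀ a b → Dec (InP₂ (scale N (a , b)))
    InP₂? a b = ℚ.∣ b ℚ./ N ∣ ℚ.≤? ℚ.1ℚ ℚ.- (a ℚ./ N) ℚ.* (a ℚ./ N)
    column : ∀ a → sum (map (λ b → 𝟙 (InP₂? a b)) (symRange N)) ≡ columnSize ℤ.∣ a ∣
    column a = trans
      (cong sum (map-cong (λ b → 𝟙-cong (inP₂-scale⇔ N a b) (InP₂? a b) (N * ℤ.∣ b ∣ + ℤ.∣ a ∣ * ℤ.∣ a ∣ ≤? N * N)) (symRange N)))
      (sum-symRange N (inNP₂ ℤ.∣ a ∣))
    centre : columnSize 0 ≡ 1 + 2 * N
    centre = trans (columnSize≡ 0 z≤n) (cong (λ q → 1 + 2 * q) (m*n/n≡m N N))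
    sides : ∑< N (columnSize ∘ suc) ≡ N + 2 * ∑< N F
    sides = begin
      ∑< N (columnSize ∘ suc)       ≡⟨ ∑<-cong N (λ x x<N → columnSize≡ (suc x) x<N) ⟩
      ∑[ x < N ] (1 + 2 * F x)      ≡⟨ ∑<-distrib-+ N ⟩
      ∑[ x < N ] 1 + ∑[ x < N ] (2 * F x) ≡⟨ cong₂ _+_ (trans (∑<-const N 1) (*-identityʳ N)) (∑<-*ˡ N 2 F) ⟩
      N + 2 * ∑< N F                ∎
    regroup : ∀ n s → 1 + 2 * n + 2 * (n + 2 * s) ≡ 1 + 4 * n + 4 * s
    regroup = solve-∀

∣∧<⇒≡0 : ∀ {n a} → n ∣ a → a < n → a ≡ 0
∣∧<⇒≡0 {a = zero}  _   _   = refl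
∣∧<⇒≡0 {a = suc _} n∣a a<n = contradiction n∣a (>⇒∤ a<n)

∣∧<n+n⇒≡0⊎≡n : ∀ {n a} → n ∣ a → a < n + n → a ≡ 0 ⊎ a ≡ n
∣∧<n+n⇒≡0⊎≡n {n} (divides zero     refl) _      = inj₁ refl
∣∧<n+n⇒≡0⊎≡n {n} (divides 1        refl) _      = inj₂ (+-identityʳ n)
∣∧<n+n⇒≡0⊎≡n {n} (divides (2+ k)   refl) a<n+n = contradiction (+-monoʳ-≤ n (m≤m+n n (k * n))) (<⇒≱ a<n+n)

-- Congruence to 0 is stated as divisibility, because 0 % n does not reduce for a variable n.
module Mod (n : ℕ) .{{_ : NonZero n}} where

  infix 4 _≡ₘ_
  _≡ₘ_ : ℕ → ℕ → Set
  a ≡ₘ b = a % n ≡ b % n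

  +-congₘ : ∀ {a a′ b b′} → a ≡ₘ a′ → b ≡ₘ b′ → a + b ≡ₘ a′ + b′
  +-congₘ {a} {a′} {b} {b′} a≡a′ b≡b′ = begin
    (a + b) % n               ≡⟨ %-distribˡ-+ a b n ⟩
    (a % n + b % n) % n       ≡⟨ cong₂ (λ u v → (u + v) % n) a≡a′ b≡b′ ⟩
    (a′ % n + b′ % n) % n     ≡⟨ %-distribˡ-+ a′ b′ n ⟨
    (a′ + b′) % n             ∎
    where open ≡-Reasoning

  *-congₘ : ∀ {a a′ b b′} → a ≡ₘ a′ → b ≡ₘ b′ → a * b ≡ₘ a′ * b′
  *-congₘ {a} {a′} {b} {b′} a≡a′ b≡b′ = begin
    (a * b) % n               ≡⟨ %-distribˡ-* a b n ⟩
    (a % n * (b % n)) % n     ≡⟨ cong₂ (λ u v → (u * v) % n) a≡a′ b≡b′ ⟩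
    (a′ % n * (b′ % n)) % n   ≡⟨ %-distribˡ-* a′ b′ n ⟨
    (a′ * b′) % n             ∎
    where open ≡-Reasoning

  %≡ₘ : ∀ a → a % n ≡ₘ a
  %≡ₘ a = m%n%n≡m%n a n

  ∣-respₘ : ∀ {a b} → a ≡ₘ b → n ∣ b → n ∣ a
  ∣-respₘ {a} {b} a≡b n∣b = m%n≡0⇒n∣m a n (trans a≡b (n∣m⇒m%n≡0 b n n∣b))

  <-≡ₘ⇒≡ : ∀ {a b} → a < n → b < n → a ≡ₘ b → a ≡ b
  <-≡ₘ⇒≡ a<n b<n a≡b = trans (sym (m<n⇒m%n≡m a<n)) (trans a≡b (m<n⇒m%n≡m b<n))

  +-cancelʳₘ : ∀ {a b} c → a + c ≡ₘ b + c → a ≡ₘ b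
  +-cancelʳₘ {a} {b} c a+c≡b+c = begin
    a % n                         ≡⟨ %-remove-+ʳ a (m∣m*n c) ⟨
    (a + n * c) % n               ≡⟨ cong (_% n) (complete a) ⟩
    (a + c + pred n * c) % n      ≡⟨ +-congₘ a+c≡b+c refl ⟩
    (b + c + pred n * c) % n      ≡⟨ cong (_% n) (complete b) ⟨
    (b + n * c) % n               ≡⟨ %-remove-+ʳ b (m∣m*n c) ⟩
    b % n                         ∎
    where
    open ≡-Reasoning
    complete : ∀ x → x + n * c ≡ x + c + pred n * c
    complete x = begin
      x + n * c                ≡⟨ cong (λ k → x + k * c) (suc-pred n) ⟨
      x + suc (pred n) * c     ≡⟨ expand x c (pred n) ⟩
      x + c + pred n * c       ∎
      where
      expand : ∀ x c m → x + suc m * c ≡ x + c + m * c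
      expand = solve-∀

  *-inverseˡₘ : ∀ {u v} → u * v ≡ₘ 1 → ∀ x → u * (v * x) ≡ₘ x
  *-inverseˡₘ {u} {v} uv≡1 x = begin
    (u * (v * x)) % n  ≡⟨ cong (_% n) (*-assoc u v x) ⟨
    (u * v * x) % n    ≡⟨ *-congₘ uv≡1 refl ⟩
    (1 * x) % n        ≡⟨ cong (_% n) (*-identityˡ x) ⟩
    x % n              ∎
    where open ≡-Reasoning

  ∣-+-cancelʳ : ∀ {u v w} → n ∣ u + w → n ∣ v + w → u ≡ₘ v
  ∣-+-cancelʳ {u} {v} {w} n∣u+w n∣v+w =
    +-cancelʳₘ w (trans (n∣m⇒m%n≡0 (u + w) n n∣u+w) (sym (n∣m⇒m%n≡0 (v + w) n n∣v+w)))

  inverseₘ : ∀ {a} → Coprime a n → ∃ λ w → a * w ≡ₘ 1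
  inverseₘ {a} a⊥n with coprime-Bézout a⊥n
  ... | Bézout.+- x y 1+yn≡xa = x , (begin
    (a * x) % n        ≡⟨ cong (_% n) (trans (*-comm a x) (sym 1+yn≡xa)) ⟩
    (1 + y * n) % n    ≡⟨ %-remove-+ʳ 1 (n∣m*n y) ⟩
    1 % n              ∎)
    where open ≡-Reasoning
  ... | Bézout.-+ x y 1+xa≡yn = x * pred n , (begin
    (a * (x * pred n)) % n                  ≡⟨ %-remove-+ʳ _ (divides y 1+xa≡yn) ⟨
    (a * (x * pred n) + (1 + x * a)) % n    ≡⟨ cong (_% n) eq ⟩
    (1 + n * (x * a)) % n                   ≡⟨ %-remove-+ʳ 1 (m∣m*n (x * a)) ⟩
    1 % n                                   ∎)
    where
    open ≡-Reasoning
    eq : a * (x * pred n) + (1 + x * a) ≡ 1 + n * (x * a)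
    eq = begin
      a * (x * pred n) + (1 + x * a) ≡⟨ expand a x (pred n) ⟩
      1 + suc (pred n) * (x * a)    ≡⟨ cong (λ k → 1 + k * (x * a)) (suc-pred n) ⟩
      1 + n * (x * a)               ∎
      where
      expand : ∀ a x m → a * (x * m) + (1 + x * a) ≡ 1 + suc m * (x * a)
      expand = solve-∀

-- Squares modulo N when −1 is a square

module _ (N : ℕ) .{{_ : NonZero N}} where
  open Mod N

  -- For x ≤ N, negSqRes x is the residue of −x².
  sqRes negSqRes : ℕ → ℕ
  sqRes    x = (x * x) % N
  negSqRes x = (N * N ∸ x * x) % N

  N∣negSqRes+sqRes : ∀ {x} → x ≤ N → N ∣ negSqRes x + sqRes x
  N∣negSqRes+sqRes {x} x≤N = ∣-respₘ (+-congₘ (%≡ₘ (N * N ∸ x * x)) (%≡ₘ (x * x)))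
    (subst (N ∣_) (sym (m∸n+n≡m (*-mono-≤ x≤N x≤N))) (m∣m*n N))

  negSqRes+sqRes+𝟙 : ∀ {x} → x ≤ N → negSqRes x + sqRes x + N * 𝟙 (N ∣? x * x) ≡ N
  negSqRes+sqRes+𝟙 {x} x≤N with N ∣? x * x
  ... | yes N∣x² = begin
    negSqRes x + sqRes x + N * 1 ≡⟨ cong₂ (λ u v → u + v + N * 1) negSqRes≡0 sqRes≡0 ⟩
    N * 1                        ≡⟨ *-identityʳ N ⟩
    N                            ∎
    where
    open ≡-Reasoning
    sqRes≡0 : sqRes x ≡ 0
    sqRes≡0 = n∣m⇒m%n≡0 (x * x) N N∣x²
    negSqRes≡0 : negSqRes x ≡ 0
    negSqRes≡0 = ∣∧<⇒≡0 N∣negSqRes (m%n<n _ N)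
      where
      N∣negSqRes : N ∣ negSqRes x
      N∣negSqRes = subst (N ∣_) (trans (cong (negSqRes x +_) sqRes≡0) (+-identityʳ _)) (N∣negSqRes+sqRes x≤N)
  ... | no N∤x² = trans (cong (negSqRes x + sqRes x +_) (*-zeroʳ N)) (trans (+-identityʳ _) sum≡N)
    where
    sum≡N : negSqRes x + sqRes x ≡ N
    sum≡N with ∣∧<n+n⇒≡0⊎≡n (N∣negSqRes+sqRes x≤N) (+-mono-< (m%n<n _ N) (m%n<n _ N))
    ... | inj₁ sum≡0 = contradiction (m%n≡0⇒n∣m (x * x) N (m+n≡0⇒n≡0 (negSqRes x) sum≡0)) N∤x²
    ... | inj₂ sum≡N = sum≡N

  module _ (i : ℕ) (N∣i²+1 : N ∣ i * i + 1) where

    private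
      -- j ≡ −i is the inverse of i, because i² ≡ −1.
      j : ℕ
      j = pred N * i

      σ τ : ℕ → ℕ
      σ x = (i * x) % N
      τ y = (j * y) % N

      N∣sqRes∘σ+sqRes : ∀ x → N ∣ sqRes (σ x) + sqRes x
      N∣sqRes∘σ+sqRes x =
        ∣-respₘ (+-congₘ (trans (%≡ₘ (σ x * σ x)) (*-congₘ (%≡ₘ (i * x)) (%≡ₘ (i * x)))) (%≡ₘ (x * x)))
        (subst (N ∣_) (expand i x) (∣-trans N∣i²+1 (m∣m*n (x * x))))
        where
        expand : ∀ i x → (i * i + 1) * (x * x) ≡ i * x * (i * x) + x * x
        expand = solve-∀

      negSqRes≡sqRes∘σ : ∀ {x} → x ≤ N → negSqRes x ≡ sqRes (σ x)
      negSqRes≡sqRes∘σ {x} x≤N = <-≡ₘ⇒≡ (m%n<n _ N) (m%n<n _ N)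
        (∣-+-cancelʳ (N∣negSqRes+sqRes x≤N) (N∣sqRes∘σ+sqRes x))

      j*i≡ₘ1 : j * i ≡ₘ 1
      j*i≡ₘ1 = begin
        (j * i) % N                  ≡⟨ %-remove-+ʳ (j * i) N∣i²+1 ⟨
        (j * i + (i * i + 1)) % N    ≡⟨ cong (_% N) (trans (regroup (pred N) i) (cong (λ n → n * (i * i) + 1) (suc-pred N))) ⟩
        (N * (i * i) + 1) % N        ≡⟨ cong (_% N) (+-comm (N * (i * i)) 1) ⟩
        (1 + N * (i * i)) % N        ≡⟨ %-remove-+ʳ 1 (m∣m*n (i * i)) ⟩
        1 % N                        ∎
        where
        open ≡-Reasoning
        regroup : ∀ m i → m * i * i + (i * i + 1) ≡ suc m * (i * i) + 1
        regroup = solve-∀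

      i*j≡ₘ1 : i * j ≡ₘ 1
      i*j≡ₘ1 = trans (cong (_% N) (*-comm i j)) j*i≡ₘ1

      τ∘σ : ∀ x → x < N → τ (σ x) ≡ x
      τ∘σ x x<N = <-≡ₘ⇒≡ (m%n<n _ N) x<N
        (trans (%≡ₘ (j * σ x)) (trans (*-congₘ {j} refl (%≡ₘ (i * x))) (*-inverseˡₘ {j} {i} j*i≡ₘ1 x)))

      σ∘τ : ∀ x → x < N → σ (τ x) ≡ x
      σ∘τ x x<N = <-≡ₘ⇒≡ (m%n<n _ N) x<N
        (trans (%≡ₘ (i * τ x)) (trans (*-congₘ {i} refl (%≡ₘ (j * x))) (*-inverseˡₘ {i} {j} i*j≡ₘ1 x)))

    ∑<-negSqRes≡∑<-sqRes : ∑< N negSqRes ≡ ∑< N sqRes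
    ∑<-negSqRes≡∑<-sqRes = trans (∑<-cong N (λ x x<N → negSqRes≡sqRes∘σ (<⇒≤ x<N)))
      (∑<-permute N σ τ (λ x _ → m%n<n _ N) (λ x _ → m%n<n _ N) τ∘σ σ∘τ sqRes)

    2*∑<-negSqRes : 2 * ∑< N negSqRes + N * ∑[ x < N ] 𝟙 (N ∣? x * x) ≡ N * N
    2*∑<-negSqRes = begin
      2 * ∑< N negSqRes + N * ∑< N divides²
        ≡⟨ cong (λ t → ∑< N negSqRes + t + N * ∑< N divides²) (trans (+-identityʳ _) ∑<-negSqRes≡∑<-sqRes) ⟩
      ∑< N negSqRes + ∑< N sqRes + N * ∑< N divides²
        ≡⟨ cong₂ _+_ (∑<-distrib-+ N) (∑<-*ˡ N N divides²) ⟨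
      ∑[ x < N ] (negSqRes x + sqRes x) + ∑[ x < N ] (N * divides² x)
        ≡⟨ ∑<-distrib-+ N ⟨
      ∑[ x < N ] (negSqRes x + sqRes x + N * divides² x)
        ≡⟨ ∑<-cong N (λ x x<N → negSqRes+sqRes+𝟙 (<⇒≤ x<N)) ⟩
      ∑[ x < N ] N
        ≡⟨ ∑<-const N N ⟩
      N * N
        ∎
      where
      open ≡-Reasoning
      divides² : ℕ → ℕ
      divides² x = 𝟙 (N ∣? x * x)

-- Squares divisible by N

leastWitness : ∀ {p} {P : ℕ → Set p} → Decidable P → ∀ n → P n → ∃ λ g → P g × (∀ {j} → P j → g ≤ j)
leastWitness {p} {P} P? = <-rec (λ n → P n → Least) step
  where
  Least : Set p
  Least = ∃ λ g → P g × (∀ {j} → P j → g ≤ j)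
  step : ∀ n → (∀ {m} → m < n → P m → Least) → P n → Least
  step n rec Pn with anyUpTo? P? n
  ... | yes (m , m<n , Pm) = rec m<n Pm
  ... | no ∄m<n           = n , Pn , λ {j} Pj → ≮⇒≥ (λ j<n → ∄m<n (j , j<n , Pj))

coprime-* : ∀ {m n o} → Coprime m n → Coprime m o → Coprime m (n * o)
coprime-* {m} {n} {o} m⊥n m⊥o {d} (d∣m , d∣no) = m⊥o (d∣m , coprime-divisor d⊥n d∣no)
  where
  d⊥n : Coprime d n
  d⊥n (k∣d , k∣n) = m⊥n (∣-trans k∣d d∣m , k∣n)

∣-gcd² : ∀ n a b .{{_ : NonZero b}} → n ∣ a * a → n ∣ b * b → n ∣ gcd a b * gcd a b
∣-gcd² n a b n∣a² n∣b² =
  coprime-factors a′²⊥b′² (subst (n ∣_) (split a (gcd[m,n]∣m a b)) n∣a² , subst (n ∣_) (split b (gcd[m,n]∣n a b)) n∣b²)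
  where
  d = gcd a b
  instance
    d≢0 : NonZero d
    d≢0 = ≢-nonZero (gcd[m,n]≢0 a b (inj₂ (≢-nonZero⁻¹ b)))
  a′⊥b′ : Coprime (a ℕ./ d) (b ℕ./ d)
  a′⊥b′ = coprime-/gcd a b
  a′⊥b′² : Coprime (a ℕ./ d) (b ℕ./ d * (b ℕ./ d))
  a′⊥b′² = coprime-* a′⊥b′ a′⊥b′
  a′²⊥b′² : Coprime (a ℕ./ d * (a ℕ./ d)) (b ℕ./ d * (b ℕ./ d))
  a′²⊥b′² = ⊥-sym (coprime-* (⊥-sym a′⊥b′²) (⊥-sym a′⊥b′²))
  split : ∀ x → d ∣ x → x * x ≡ (x ℕ./ d * (x ℕ./ d)) * (d * d)
  split x d∣x = trans (cong₂ _*_ (sym (m/n*n≡m d∣x)) (sym (m/n*n≡m d∣x))) (regroup (x ℕ./ d) d)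
    where
    regroup : ∀ u v → (u * v) * (u * v) ≡ (u * u) * (v * v)
    regroup = solve-∀

∑<-𝟙-∣ : ∀ g .{{_ : NonZero g}} k → ∑[ x < k * g ] 𝟙 (g ∣? x) ≡ k
∑<-𝟙-∣ g       zero    = refl
∑<-𝟙-∣ g@(suc g′) (suc k) = begin
  ∑< (g + k * g) multiple              ≡⟨ ∑<-+ g (k * g) multiple ⟩
  ∑< g multiple + ∑[ x < k * g ] multiple (g + x)
    ≡⟨ cong₂ _+_ first-period (∑<-cong (k * g) (λ x _ → 𝟙-cong shift (g ∣? (g + x)) (g ∣? x))) ⟩
  1 + ∑< (k * g) multiple              ≡⟨ cong suc (∑<-𝟙-∣ g k) ⟩
  suc k                               ∎
  where
  open ≡-Reasoning
  multiple : ℕ → ℕ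
  multiple x = 𝟙 (g ∣? x)
  first-period : ∑< g multiple ≡ 1
  first-period = begin
    ∑< g multiple                        ≡⟨ ∑<-sucˡ g′ multiple ⟩
    multiple 0 + ∑< g′ (multiple ∘ suc)   ≡⟨ cong₂ _+_ (𝟙-yes (g ∣? 0) (g ∣0))
                                              (∑<-cong g′ (λ x x<g′ → 𝟙-no (g ∣? suc x) (λ g∣x → <⇒≱ (s≤s x<g′) (∣⇒≤ g∣x)))) ⟩
    1 + ∑[ x < g′ ] 0                   ≡⟨ cong suc (trans (∑<-const g′ 0) (*-zeroʳ g′)) ⟩
    1                                   ∎
  shift : ∀ {x} → (g ∣ g + x) ⇔ (g ∣ x)
  shift = mk⇔ (λ g∣g+x → ∣m+n∣m⇒∣n g∣g+x ∣-refl) (∣m∣n⇒∣m+n ∣-refl)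

-- With g the least positive number such that N ∣ g², the x with N ∣ x² are the multiples of g,
-- and N / g is the square root of the greatest square dividing N.
module _ (N : ℕ) .{{_ : NonZero N}} where

  private
    PositiveRoot : ℕ → Set
    PositiveRoot k = 0 < k × N ∣ k * k

    least : ∃ λ g → PositiveRoot g × (∀ {k} → PositiveRoot k → g ≤ k)
    least = leastWitness (λ k → 0 <? k ×-dec N ∣? k * k) N (>-nonZero⁻¹ N , m∣m*n N)

    g : ℕ
    g = proj₁ least

    0<g : 0 < g
    0<g = proj₁ (proj₁ (proj₂ least))

    instance
      g≢0 : NonZero g
      g≢0 = >-nonZero 0<g

    N∣g² : N ∣ g * g
    N∣g² = proj₂ (proj₁ (proj₂ least))

    g-minimal : ∀ {k} → 0 < k → N ∣ k * k → g ≤ k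
    g-minimal 0<k N∣k² = proj₂ (proj₂ least) (0<k , N∣k²)

    N∣x²⇔g∣x : ∀ x → N ∣ x * x ⇔ g ∣ x
    N∣x²⇔g∣x x = mk⇔ to (λ g∣x → ∣-trans N∣g² (*-pres-∣ g∣x g∣x))
      where
      to : N ∣ x * x → g ∣ x
      to N∣x² = subst (_∣ x) gcd≡g (gcd[m,n]∣m x g)
        where
        gcd≡g : gcd x g ≡ g
        gcd≡g = ≤-antisym (gcd[m,n]≤n x g)
          (g-minimal (n≢0⇒n>0 (gcd[m,n]≢0 x g (inj₂ (≢-nonZero⁻¹ g)))) (∣-gcd² N x g N∣x² N∣g²))

    g∣N : g ∣ N
    g∣N = Equivalence.to (N∣x²⇔g∣x N) (m∣m*n N)

    t : ℕ
    t = quotient g∣N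

    N≡t*g : N ≡ t * g
    N≡t*g = m∣n⇒n≡quotient*m g∣N

    t²∣N : t * t ∣ N
    t²∣N = subst (t * t ∣_) (sym N≡t*g) (*-monoʳ-∣ t t∣g)
      where
      t∣g : t ∣ g
      t∣g = *-cancelʳ-∣ g (subst (_∣ g * g) N≡t*g N∣g²)

  ∑<-𝟙-N∣x² : ∀ {N* s} → IsGreatestSquareDivisor N N* → s * s ≡ N* → ∑[ x < N ] 𝟙 (N ∣? x * x) ≡ s
  ∑<-𝟙-N∣x² {N*} {s} (_ , N*∣N , N*-greatest) s²≡N* = begin
    ∑[ x < N ] 𝟙 (N ∣? x * x)     ≡⟨ ∑<-cong N (λ x _ → 𝟙-cong (N∣x²⇔g∣x x) (N ∣? x * x) (g ∣? x)) ⟩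
    ∑[ x < N ] 𝟙 (g ∣? x)         ≡⟨ cong (λ n → ∑[ x < n ] 𝟙 (g ∣? x)) N≡t*g ⟩
    ∑[ x < t * g ] 𝟙 (g ∣? x)     ≡⟨ ∑<-𝟙-∣ g t ⟩
    t                             ≡⟨ ≤-antisym t≤s s≤t ⟩
    s                             ∎
    where
    open ≡-Reasoning
    t≤s : t ≤ s
    t≤s = ≮⇒≥ (λ s<t → <⇒≱ (*-mono-< s<t s<t) (subst (t * t ≤_) (sym s²≡N*) (N*-greatest t t²∣N)))
    s²∣N : s * s ∣ N
    s²∣N = subst (_∣ N) (sym s²≡N*) N*∣N
    w = quotient s²∣N
    N≡w*s² : N ≡ w * (s * s)
    N≡w*s² = m∣n⇒n≡quotient*m s²∣N
    u = w * s
    s*u≡N : s * u ≡ N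
    s*u≡N = trans (reassoc s w) (sym N≡w*s²)
      where
      reassoc : ∀ s w → s * (w * s) ≡ w * (s * s)
      reassoc = solve-∀
    u²≡N*w : u * u ≡ N * w
    u²≡N*w = trans (reassoc w s) (cong (_* w) (sym N≡w*s²))
      where
      reassoc : ∀ w s → w * s * (w * s) ≡ w * (s * s) * w
      reassoc = solve-∀
    0<u : 0 < u
    0<u = n≢0⇒n>0 (λ u≡0 → ≢-nonZero⁻¹ N (trans (sym s*u≡N) (trans (cong (s *_) u≡0) (*-zeroʳ s))))
    g≤u : g ≤ u
    g≤u = g-minimal 0<u (subst (N ∣_) (sym u²≡N*w) (m∣m*n w))
    s≤t : s ≤ t
    s≤t = ≮⇒≥ (λ t<s → <-irrefl refl (subst₂ _<_ (sym N≡t*g) s*u≡N (<-≤-trans (*-monoˡ-< g t<s) (*-monoʳ-≤ s g≤u))))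

-- The count in closed form

6*∑<-squares : ∀ n → 6 * ∑[ x < n ] (suc x * suc x) ≡ n * (n + 1) * (2 * n + 1)
6*∑<-squares zero    = refl
6*∑<-squares (suc n) = begin
  6 * (∑[ x < n ] (suc x * suc x) + suc n * suc n)          ≡⟨ *-distribˡ-+ 6 (∑[ x < n ] (suc x * suc x)) _ ⟩
  6 * ∑[ x < n ] (suc x * suc x) + 6 * (suc n * suc n)      ≡⟨ cong (_+ 6 * (suc n * suc n)) (6*∑<-squares n) ⟩
  n * (n + 1) * (2 * n + 1) + 6 * (suc n * suc n)           ≡⟨ solve (n ∷ []) ⟩
  suc n * (suc n + 1) * (2 * suc n + 1)                     ∎
  where open ≡-Reasoning

3k≡8n²+1+6s : ∀ n a b c s k .{{_ : NonZero n}} →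
  n * a + b + c ≡ n * (n * n) → 2 * b + n * s ≡ n * n → 6 * c ≡ n * (n + 1) * (2 * n + 1) → k ≡ 1 + 4 * n + 4 * a →
  3 * k ≡ 8 * (n * n) + 1 + 6 * s
3k≡8n²+1+6s n a b c s k E₁ E₂ E₃ refl = *-cancelˡ-≡ _ _ n (+-cancelʳ-≡ (12 * b + 12 * c) _ _ (begin
  n * (3 * (1 + 4 * n + 4 * a)) + (12 * b + 12 * c)     ≡⟨ solve (n ∷ a ∷ b ∷ c ∷ []) ⟩
  12 * (n * a + b + c) + 12 * (n * n) + 3 * n           ≡⟨ cong (λ t → 12 * t + 12 * (n * n) + 3 * n) E₁ ⟩
  12 * (n * (n * n)) + 12 * (n * n) + 3 * n             ≡⟨ solve (n ∷ []) ⟩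
  8 * (n * (n * n)) + n + 6 * (n * n) + 2 * (n * (n + 1) * (2 * n + 1))
    ≡⟨ cong₂ (λ u v → 8 * (n * (n * n)) + n + 6 * u + 2 * v) E₂ E₃ ⟨
  8 * (n * (n * n)) + n + 6 * (2 * b + n * s) + 2 * (6 * c) ≡⟨ solve (n ∷ b ∷ c ∷ s ∷ []) ⟩
  n * (8 * (n * n) + 1 + 6 * s) + (12 * b + 12 * c)     ∎))
  where open ≡-Reasoning

module _ (N : ℕ) .{{_ : NonZero N}} where

  N*⌊⌋+negSqRes+sq : ∀ {x} → x ≤ N → N * ((N * N ∸ x * x) ℕ./ N) + negSqRes N x + x * x ≡ N * N
  N*⌊⌋+negSqRes+sq {x} x≤N = begin
    N * (d ℕ./ N) + d % N + x * x   ≡⟨ cong (_+ x * x) (trans (+-comm (N * (d ℕ./ N)) (d % N)) (cong (d % N +_) (*-comm N (d ℕ./ N)))) ⟩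
    d % N + d ℕ./ N * N + x * x     ≡⟨ cong (_+ x * x) (m≡m%n+[m/n]*n d N) ⟨
    d + x * x                     ≡⟨ m∸n+n≡m (*-mono-≤ x≤N x≤N) ⟩
    N * N                         ∎
    where
    open ≡-Reasoning
    d = N * N ∸ x * x

  3*𝒩₂ : ∀ i → N ∣ i * i + 1 → ∀ {N* s} → IsGreatestSquareDivisor N N* → s * s ≡ N* →
    3 * 𝒩₂ N ≡ 8 * (N * N) + 1 + 6 * s
  3*𝒩₂ i N∣i²+1 {s = s} N*-greatest s²≡N* =
    3k≡8n²+1+6s N (∑< N F) (∑< N r) (∑< N sq) s (𝒩₂ N) E₁ E₂ (6*∑<-squares N) (𝒩₂-floorSum N)
    where
    F r sq : ℕ → ℕ
    F x  = (N * N ∸ suc x * suc x) ℕ./ N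
    r x  = negSqRes N (suc x)
    sq x = suc x * suc x
    E₁ : N * ∑< N F + ∑< N r + ∑< N sq ≡ N * (N * N)
    E₁ = begin
      N * ∑< N F + ∑< N r + ∑< N sq              ≡⟨ cong (λ t → t + ∑< N r + ∑< N sq) (∑<-*ˡ N N F) ⟨
      ∑[ x < N ] (N * F x) + ∑< N r + ∑< N sq    ≡⟨ cong (_+ ∑< N sq) (∑<-distrib-+ N) ⟨
      ∑[ x < N ] (N * F x + r x) + ∑< N sq       ≡⟨ ∑<-distrib-+ N ⟨
      ∑[ x < N ] (N * F x + r x + sq x)          ≡⟨ ∑<-cong N (λ x x<N → N*⌊⌋+negSqRes+sq x<N) ⟩
      ∑[ x < N ] (N * N)                         ≡⟨ ∑<-const N (N * N) ⟩
      N * (N * N)                                ∎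
      where open ≡-Reasoning
    negSqRes0≡negSqResN : negSqRes N 0 ≡ negSqRes N N
    negSqRes0≡negSqResN = begin
      (N * N) % N       ≡⟨ m*n%n≡0 N N ⟩
      0                 ≡⟨ n∣m⇒m%n≡0 0 N (N ∣0) ⟨
      0 % N             ≡⟨ cong (_% N) (n∸n≡0 (N * N)) ⟨
      (N * N ∸ N * N) % N ∎
      where open ≡-Reasoning
    E₂ : 2 * ∑< N r + N * s ≡ N * N
    E₂ = trans (cong₂ (λ u v → 2 * u + N * v) (∑<-rotate N (negSqRes N) negSqRes0≡negSqResN)
                                              (sym (∑<-𝟙-N∣x² N N*-greatest s²≡N*)))
               (2*∑<-negSqRes N i N∣i²+1)

-- Square roots of −1 modulo N

module _ (n : ℕ) (ψ : ℕ → ℕ) (ψ<n : ∀ {i} → i < n → ψ i < n) (ψ∘ψ : ∀ {i} → i < n → ψ (ψ i) ≡ i) where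

  involution-count : n ≡ 2 * ∑[ i < n ] 𝟙 (i <? ψ i) + ∑[ i < n ] 𝟙 (ψ i ≟ i)
  involution-count = begin
    n                                  ≡⟨ trans (∑<-const n 1) (*-identityʳ n) ⟨
    ∑[ i < n ] 1                       ≡⟨ ∑<-cong n (λ i _ → trichotomy i) ⟨
    ∑[ i < n ] (up i + down i + fixed i) ≡⟨ trans (∑<-distrib-+ n) (cong (_+ ∑< n fixed) (∑<-distrib-+ n)) ⟩
    ∑< n up + ∑< n down + ∑< n fixed   ≡⟨ cong (λ t → ∑< n up + t + ∑< n fixed) (trans ∑down≡∑up (sym (+-identityʳ _))) ⟩
    2 * ∑< n up + ∑< n fixed           ∎
    where
    open ≡-Reasoning
    up down fixed : ℕ → ℕ
    up    i = 𝟙 (i <? ψ i)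
    down  i = 𝟙 (ψ i <? i)
    fixed i = 𝟙 (ψ i ≟ i)
    trichotomy : ∀ i → up i + down i + fixed i ≡ 1
    trichotomy i with <-cmp i (ψ i)
    ... | tri< i<ψi i≢ψi _   = trans (cong₂ (λ u v → u + v + fixed i) (𝟙-yes (i <? ψ i) i<ψi) (𝟙-no (ψ i <? i) (<⇒≯ i<ψi)))
                                       (cong suc (𝟙-no (ψ i ≟ i) (i≢ψi ∘ sym)))
    ... | tri≈ _ i≡ψi _      = trans (cong₂ (λ u v → u + v + fixed i) (𝟙-no (i <? ψ i) (<-irrefl i≡ψi)) (𝟙-no (ψ i <? i) (<-irrefl (sym i≡ψi))))
                                       (𝟙-yes (ψ i ≟ i) (sym i≡ψi))
    ... | tri> _ i≢ψi ψi<i   = trans (cong₂ (λ u v → u + v + fixed i) (𝟙-no (i <? ψ i) (<⇒≯ ψi<i)) (𝟙-yes (ψ i <? i) ψi<i))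
                                       (cong suc (𝟙-no (ψ i ≟ i) (i≢ψi ∘ sym)))
    ∑down≡∑up : ∑< n down ≡ ∑< n up
    ∑down≡∑up = begin
      ∑< n down            ≡⟨ ∑<-permute n ψ ψ (λ _ → ψ<n) (λ _ → ψ<n) (λ _ → ψ∘ψ) (λ _ → ψ∘ψ) down ⟨
      ∑< n (down ∘ ψ)      ≡⟨ ∑<-cong n (λ i i<n → 𝟙-cong (mk⇔ (subst (_< ψ i) (ψ∘ψ i<n)) (subst (_< ψ i) (sym (ψ∘ψ i<n))))
                                                            (ψ (ψ i) <? ψ i) (i <? ψ i)) ⟩
      ∑< n up              ∎

  involution-even⇒fixedPoint : ψ 0 ≡ 0 → ∀ k → n ≡ 2 * k → 0 < n → ∃ λ i → 0 < i × i < n × ψ i ≡ i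
  involution-even⇒fixedPoint ψ0≡0 k n≡2k 0<n@(s≤s {n = n′} _) with anyUpTo? (λ i → 0 <? i ×-dec ψ i ≟ i) n
  ... | yes (i , i<n , 0<i , ψi≡i) = i , 0<i , i<n , ψi≡i
  ... | no ∄i = contradiction 2k≡1+2A (even≢odd k A)
    where
    A = ∑[ i < n ] 𝟙 (i <? ψ i)
    one-fixed : ∑[ i < n ] 𝟙 (ψ i ≟ i) ≡ 1
    one-fixed = begin
      ∑[ i < n ] 𝟙 (ψ i ≟ i)                          ≡⟨ ∑<-sucˡ n′ (λ i → 𝟙 (ψ i ≟ i)) ⟩
      𝟙 (ψ 0 ≟ 0) + ∑[ i < n′ ] 𝟙 (ψ (suc i) ≟ suc i) ≡⟨ cong₂ _+_ (𝟙-yes (ψ 0 ≟ 0) ψ0≡0)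
                                                           (∑<-cong n′ (λ i i<n′ → 𝟙-no (ψ (suc i) ≟ suc i) (λ fixed → ∄i (suc i , s≤s i<n′ , z<s , fixed)))) ⟩
      1 + ∑[ i < n′ ] 0                               ≡⟨ cong suc (trans (∑<-const n′ 0) (*-zeroʳ n′)) ⟩
      1                                               ∎
      where open ≡-Reasoning
    2k≡1+2A : 2 * k ≡ suc (2 * A)
    2k≡1+2A = trans (sym n≡2k) (trans involution-count (trans (cong (2 * A +_) one-fixed) (+-comm (2 * A) 1)))

module _ {p : ℕ} (p-prime : Prime p) where

  private instance
    p≢0 : NonZero p
    p≢0 = prime⇒nonZero p-prime

  open Mod p

  prime-∤⇒coprime : ∀ {x} → p ∤ x → Coprime x p
  prime-∤⇒coprime p∤x (d∣x , d∣p) with prime⇒irreducible p-prime d∣p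
  ... | inj₁ d≡1 = d≡1
  ... | inj₂ refl = contradiction d∣x p∤x

  infix 4 _≡±_
  _≡±_ : ℕ → ℕ → Set
  a ≡± b = a ≡ₘ b ⊎ p ∣ a + b

  ≡±-sym : ∀ {a b} → a ≡± b → b ≡± a
  ≡±-sym {a} {b} (inj₁ a≡b)   = inj₁ (sym a≡b)
  ≡±-sym {a} {b} (inj₂ p∣a+b) = inj₂ (subst (p ∣_) (+-comm a b) p∣a+b)

  ≡±-trans : ∀ {a b c} → a ≡± b → b ≡± c → a ≡± c
  ≡±-trans         (inj₁ a≡b)   (inj₁ b≡c)   = inj₁ (trans a≡b b≡c)
  ≡±-trans         (inj₁ a≡b)   (inj₂ p∣b+c) = inj₂ (∣-respₘ (+-congₘ a≡b refl) p∣b+c)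
  ≡±-trans         (inj₂ p∣a+b) (inj₁ b≡c)   = inj₂ (∣-respₘ (+-congₘ refl (sym b≡c)) p∣a+b)
  ≡±-trans {a} {b} {c} (inj₂ p∣a+b) (inj₂ p∣b+c) = inj₁ (∣-+-cancelʳ p∣a+b (subst (p ∣_) (+-comm b c) p∣b+c))

  ≡±-*ˡ : ∀ c {a b} → a ≡± b → c * a ≡± c * b
  ≡±-*ˡ c         (inj₁ a≡b)   = inj₁ (*-congₘ {c} refl a≡b)
  ≡±-*ˡ c {a} {b} (inj₂ p∣a+b) = inj₂ (subst (p ∣_) (*-distribˡ-+ c a b) (∣n⇒∣m*n c p∣a+b))

  ≡±-cancel-*ˡ : ∀ {x a b} → p ∤ x → x * a ≡± x * b → a ≡± b
  ≡±-cancel-*ˡ {x} {a} {b} p∤x (inj₁ xa≡xb) =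
    inj₁ (trans (sym (*-inverseˡₘ {u} {x} u*x≡1 a)) (trans (*-congₘ {u} refl xa≡xb) (*-inverseˡₘ {u} {x} u*x≡1 b)))
    where
    u = proj₁ (inverseₘ (prime-∤⇒coprime p∤x))
    u*x≡1 : u * x ≡ₘ 1
    u*x≡1 = trans (cong (_% p) (*-comm u x)) (proj₂ (inverseₘ (prime-∤⇒coprime p∤x)))
  ≡±-cancel-*ˡ {x} {a} {b} p∤x (inj₂ p∣xa+xb) with euclidsLemma x (a + b) p-prime (subst (p ∣_) (sym (*-distribˡ-+ x a b)) p∣xa+xb)
  ... | inj₁ p∣x   = contradiction p∣x p∤x
  ... | inj₂ p∣a+b = inj₂ p∣a+b

  module _ {h : ℕ} (p≡2h+1 : p ≡ 2 * h + 1) where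

    private
      ≤h+≤h<p : ∀ {a b} → a ≤ h → b ≤ h → a + b < p
      ≤h+≤h<p a≤h b≤h = subst (_ <_) (trans (+-comm 1 (2 * h)) (sym p≡2h+1))
        (s≤s (≤-trans (+-mono-≤ a≤h b≤h) (≤-reflexive (solve (h ∷ [])))))

      ≤h⇒<p : ∀ {x} → x ≤ h → x < p
      ≤h⇒<p {x} x≤h = ≤-<-trans (m≤m+n x 0) (≤h+≤h<p x≤h z≤n)

      0<x∧x<p⇒p∤x : ∀ {x} → 0 < x → x < p → p ∤ x
      0<x∧x<p⇒p∤x 0<x = >⇒∤ {{>-nonZero 0<x}}

      ≤h⇒∤ : ∀ {x} → 0 < x → x ≤ h → p ∤ x
      ≤h⇒∤ 0<x x≤h = 0<x∧x<p⇒p∤x 0<x (≤h⇒<p x≤h)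

      ≡±⇒≡ : ∀ {a b} → 0 < a → a ≤ h → 0 < b → b ≤ h → a ≡± b → a ≡ b
      ≡±⇒≡ _   a≤h _ b≤h (inj₁ a≡b)   = <-≡ₘ⇒≡ (≤h⇒<p a≤h) (≤h⇒<p b≤h) a≡b
      ≡±⇒≡ 0<a a≤h _ b≤h (inj₂ p∣a+b) = contradiction p∣a+b (0<x∧x<p⇒p∤x (<-≤-trans 0<a (m≤m+n _ _)) (≤h+≤h<p a≤h b≤h))

      p∤1 : p ∤ 1
      p∤1 p∣1 = ¬prime[1] (subst Prime (∣1⇒≡1 p∣1) p-prime)

      inverse : ∀ x → ∃ λ u → p ∤ x → x * u ≡ₘ 1
      inverse x with p ∣? x
      ... | yes p∣x = 0 , λ p∤x → contradiction p∣x p∤x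
      ... | no  p∤x = proj₁ (inverseₘ (prime-∤⇒coprime p∤x)) , λ _ → proj₂ (inverseₘ (prime-∤⇒coprime p∤x))

      inv : ℕ → ℕ
      inv x = proj₁ (inverse x) % p

      inv-correct : ∀ {x} → p ∤ x → x * inv x ≡ₘ 1
      inv-correct {x} p∤x = trans (*-congₘ {x} refl (%≡ₘ (proj₁ (inverse x)))) (proj₂ (inverse x) p∤x)

      0<inv : ∀ {x} → p ∤ x → 0 < inv x
      0<inv {x} p∤x = n≢0⇒n>0 (λ inv≡0 → p∤1 (∣-respₘ (sym (0≡ₘ1 inv≡0)) (p ∣0)))
        where
        0≡ₘ1 : inv x ≡ 0 → 0 ≡ₘ 1
        0≡ₘ1 inv≡0 = trans (cong (_% p) (sym (trans (cong (x *_) inv≡0) (*-zeroʳ x)))) (inv-correct p∤x)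

      fold : ℕ → ℕ
      fold y with y ≤? h
      ... | yes _ = y
      ... | no  _ = p ∸ y

      fold-range : ∀ {y} → 0 < y → y < p → 0 < fold y × fold y ≤ h
      fold-range {y} 0<y y<p with y ≤? h
      ... | yes y≤h = 0<y , y≤h
      ... | no  y≰h = m<n⇒0<n∸m y<p , (begin
        p ∸ y        ≤⟨ ∸-monoʳ-≤ p (≰⇒> y≰h) ⟩
        p ∸ suc h    ≡⟨ cong (_∸ suc h) p≡2h+1 ⟩
        2 * h + 1 ∸ suc h ≡⟨ cong (_∸ suc h) 2h+1≡[1+h]+h ⟩
        suc h + h ∸ suc h ≡⟨ m+n∸m≡n (suc h) h ⟩
        h            ∎)
        where
        open ≤-Reasoning
        2h+1≡[1+h]+h : 2 * h + 1 ≡ suc h + h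
        2h+1≡[1+h]+h = solve (h ∷ [])

      fold-≡± : ∀ {y} → y < p → fold y ≡± y
      fold-≡± {y} y<p with y ≤? h
      ... | yes _ = inj₁ refl
      ... | no  _ = inj₂ (subst (p ∣_) (sym (m∸n+n≡m (<⇒≤ y<p))) ∣-refl)

      φ : ℕ → ℕ
      φ x = fold (inv x)

      module _ {x} (0<x : 0 < x) (x≤h : x ≤ h) where

        φ-range : 0 < φ x × φ x ≤ h
        φ-range = fold-range (0<inv (≤h⇒∤ 0<x x≤h)) (m%n<n _ p)

        x*φx≡±1 : x * φ x ≡± 1
        x*φx≡±1 = ≡±-trans (≡±-*ˡ x (fold-≡± (m%n<n _ p))) (inj₁ (inv-correct (≤h⇒∤ 0<x x≤h)))

        φ-unique : ∀ {z} → 0 < z → z ≤ h → x * z ≡± 1 → z ≡ φ x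
        φ-unique 0<z z≤h xz≡±1 = ≡±⇒≡ 0<z z≤h (proj₁ φ-range) (proj₂ φ-range)
          (≡±-cancel-*ˡ (≤h⇒∤ 0<x x≤h) (≡±-trans xz≡±1 (≡±-sym x*φx≡±1)))

      φ-involutive : ∀ {x} → 0 < x → x ≤ h → φ (φ x) ≡ x
      φ-involutive {x} 0<x x≤h = sym (φ-unique (proj₁ φx-range) (proj₂ φx-range) 0<x x≤h
                                    (subst (_≡± 1) (*-comm x (φ x)) (x*φx≡±1 0<x x≤h)))
        where
        φx-range = φ-range 0<x x≤h

      φ1≡1 : 0 < h → φ 1 ≡ 1
      φ1≡1 0<h = sym (φ-unique z<s 0<h z<s 0<h (inj₁ refl))

      φ-fixed⇒p∣x²+1 : ∀ {x} → 1 < x → x ≤ h → φ x ≡ x → p ∣ x * x + 1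
      φ-fixed⇒p∣x²+1 {x@(suc a)} (s≤s 0<a) x≤h φx≡x with subst (λ z → x * z ≡± 1) φx≡x (x*φx≡±1 z<s x≤h)
      ... | inj₂ p∣x²+1 = p∣x²+1
      ... | inj₁ x²≡1 with euclidsLemma a (x + 1) p-prime p∣a[x+1]
        where
        p∣a[x+1] : p ∣ a * (x + 1)
        p∣a[x+1] = ∣-respₘ (+-cancelʳₘ 1 (trans (cong (_% p) (factor a)) x²≡1)) (p ∣0)
          where
          factor : ∀ a → a * (suc a + 1) + 1 ≡ suc a * suc a
          factor = solve-∀
      ... | inj₁ p∣a   = contradiction p∣a   (≤h⇒∤ 0<a (≤-trans (n≤1+n a) x≤h))
      ... | inj₂ p∣x+1 = contradiction p∣x+1 (0<x∧x<p⇒p∤x z<s (≤h+≤h<p x≤h (≤-trans (s≤s z≤n) x≤h)))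

      ψ : ℕ → ℕ
      ψ i = pred (φ (suc i))

      suc∘ψ : ∀ {i} → i < h → suc (ψ i) ≡ φ (suc i)
      suc∘ψ i<h = suc-pred _ {{>-nonZero (proj₁ (φ-range z<s i<h))}}

      ψ<h : ∀ {i} → i < h → ψ i < h
      ψ<h i<h = subst (_≤ h) (sym (suc∘ψ i<h)) (proj₂ (φ-range z<s i<h))

      ψ∘ψ : ∀ {i} → i < h → ψ (ψ i) ≡ i
      ψ∘ψ i<h = cong pred (trans (cong φ (suc∘ψ i<h)) (φ-involutive z<s i<h))

    half-even⇒∃p∣x²+1 : 0 < h → ∀ k → h ≡ 2 * k → ∃ λ x → p ∣ x * x + 1
    half-even⇒∃p∣x²+1 0<h k h≡2k with involution-even⇒fixedPoint h ψ ψ<h ψ∘ψ (cong pred (φ1≡1 0<h)) k h≡2k 0<h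
    ... | i , 0<i , i<h , ψi≡i = suc i , φ-fixed⇒p∣x²+1 (s≤s 0<i) i<h (trans (sym (suc∘ψ i<h)) (cong suc ψi≡i))

prime≡1[4]⇒∃p∣x²+1 : ∀ {p} → Prime p → p % 4 ≡ 1 → ∃ λ x → p ∣ x * x + 1
prime≡1[4]⇒∃p∣x²+1 {p} p-prime p%4≡1 = half-even⇒∃p∣x²+1 p-prime {2 * k} p≡2h+1 0<h k refl
  where
  k = p ℕ./ 4
  p≡2h+1 : p ≡ 2 * (2 * k) + 1
  p≡2h+1 = trans (m≡m%n+[m/n]*n p 4) (trans (cong (_+ k * 4) p%4≡1) (regroup k))
    where
    regroup : ∀ k → 1 + k * 4 ≡ 2 * (2 * k) + 1
    regroup = solve-∀
  0<h : 0 < 2 * k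
  0<h = n≢0⇒n>0 (λ h≡0 → ¬prime[1] (subst Prime (trans p≡2h+1 (cong (λ h → 2 * h + 1) h≡0)) p-prime))

coprime-∣⇒*∣ : ∀ {m n x} → Coprime n m → m ∣ x → n ∣ x → m * n ∣ x
coprime-∣⇒*∣ {m} {n} {x} n⊥m m∣x n∣x = subst (m * n ∣_) (sym x≡m*q) (*-monoʳ-∣ m n∣q)
  where
  x≡m*q : x ≡ m * quotient m∣x
  x≡m*q = m∣n⇒n≡m*quotient m∣x
  n∣q : n ∣ quotient m∣x
  n∣q = coprime-divisor n⊥m (subst (n ∣_) x≡m*q n∣x)

∣x²+1-lift : ∀ {p m a} → Prime p → p ∤ 2 → p ∣ m → m ∣ a * a + 1 → ∃ λ b → p * m ∣ b * b + 1
∣x²+1-lift {p} {m} {a} p-prime p∤2 p∣m m∣a²+1 = b , subst (p * m ∣_) (sym b²+1≡X*m) (*-monoˡ-∣ m p∣X)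
  where
  instance
    p≢0 : NonZero p
    p≢0 = prime⇒nonZero p-prime
  open Mod p
  K = quotient m∣a²+1
  a²+1≡K*m : a * a + 1 ≡ K * m
  a²+1≡K*m = m∣n⇒n≡quotient*m m∣a²+1
  p∤a : p ∤ a
  p∤a p∣a = ¬prime[1] (subst Prime (∣1⇒≡1 (∣m+n∣m⇒∣n (∣-trans p∣m m∣a²+1) (∣m⇒∣m*n a p∣a))) p-prime)
  p∤2a : p ∤ 2 * a
  p∤2a p∣2a with euclidsLemma 2 a p-prime p∣2a
  ... | inj₁ p∣2 = p∤2 p∣2
  ... | inj₂ p∣a = p∤a p∣a
  w = proj₁ (inverseₘ (prime-∤⇒coprime p-prime p∤2a))
  -- t ≡ −K·(2a)⁻¹ (mod p), which makes p divide K + 2at.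
  t = K * w * pred p
  b = a + t * m
  X = K + 2 * a * t + t * t * m
  b²+1≡X*m : b * b + 1 ≡ X * m
  b²+1≡X*m = begin
    b * b + 1                              ≡⟨ expand a t m ⟩
    (a * a + 1) + (2 * a * t + t * t * m) * m ≡⟨ cong (_+ (2 * a * t + t * t * m) * m) a²+1≡K*m ⟩
    K * m + (2 * a * t + t * t * m) * m    ≡⟨ collect K a t m ⟩
    X * m                                  ∎
    where
    open ≡-Reasoning
    expand : ∀ a t m → (a + t * m) * (a + t * m) + 1 ≡ (a * a + 1) + (2 * a * t + t * t * m) * m
    expand = solve-∀
    collect : ∀ K a t m → K * m + (2 * a * t + t * t * m) * m ≡ (K + 2 * a * t + t * t * m) * m
    collect = solve-∀
  2at≡ₘK*pred[p] : 2 * a * t ≡ₘ K * pred p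
  2at≡ₘK*pred[p] = begin
    (2 * a * t) % p                ≡⟨ cong (_% p) (regroup a K w (pred p)) ⟩
    (2 * a * w * (K * pred p)) % p ≡⟨ *-congₘ (proj₂ (inverseₘ (prime-∤⇒coprime p-prime p∤2a))) refl ⟩
    (1 * (K * pred p)) % p         ≡⟨ cong (_% p) (*-identityˡ (K * pred p)) ⟩
    (K * pred p) % p               ∎
    where
    open ≡-Reasoning
    regroup : ∀ a K w q → 2 * a * (K * w * q) ≡ 2 * a * w * (K * q)
    regroup = solve-∀
  p∣K+K*pred[p] : p ∣ K + K * pred p
  p∣K+K*pred[p] = divides K (begin
    K + K * pred p       ≡⟨ cong (K +_) (*-comm K (pred p)) ⟩
    suc (pred p) * K     ≡⟨ cong (_* K) (suc-pred p) ⟩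
    p * K                ≡⟨ *-comm p K ⟩
    K * p                ∎)
    where open ≡-Reasoning
  p∣X : p ∣ X
  p∣X = ∣-respₘ (+-congₘ (+-congₘ {K} refl 2at≡ₘK*pred[p]) refl) (∣m∣n⇒∣m+n p∣K+K*pred[p] (∣n⇒∣m*n (t * t) p∣m))

∣x²+1-crt : ∀ {m n a b} .{{_ : NonZero m}} .{{_ : NonZero n}} → Coprime m n →
  m ∣ a * a + 1 → n ∣ b * b + 1 → ∃ λ c → m * n ∣ c * c + 1
∣x²+1-crt {m} {n} {a} {b} m⊥n m∣a²+1 n∣b²+1 = c , coprime-∣⇒*∣ (⊥-sym m⊥n) (lift-root m c≡a m∣a²+1) (lift-root n c≡b n∣b²+1)
  where
  w₁ = proj₁ (Mod.inverseₘ m (⊥-sym m⊥n))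
  w₂ = proj₁ (Mod.inverseₘ n m⊥n)
  c = a * (n * w₁) + b * (m * w₂)
  lift-root : ∀ k .{{_ : NonZero k}} {x y} → Mod._≡ₘ_ k x y → k ∣ y * y + 1 → k ∣ x * x + 1
  lift-root k x≡y = Mod.∣-respₘ k (Mod.+-congₘ k (Mod.*-congₘ k x≡y x≡y) refl)
  c≡a : Mod._≡ₘ_ m c a
  c≡a = begin
    c % m                ≡⟨ %-remove-+ʳ (a * (n * w₁)) (∣n⇒∣m*n b (m∣m*n w₂)) ⟩
    (a * (n * w₁)) % m   ≡⟨ Mod.*-congₘ m {a} refl (proj₂ (Mod.inverseₘ m (⊥-sym m⊥n))) ⟩
    (a * 1) % m          ≡⟨ cong (_% m) (*-identityʳ a) ⟩
    a % m                ∎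
    where open ≡-Reasoning
  c≡b : Mod._≡ₘ_ n c b
  c≡b = begin
    c % n                ≡⟨ cong (_% n) (+-comm (a * (n * w₁)) _) ⟩
    (b * (m * w₂) + a * (n * w₁)) % n ≡⟨ %-remove-+ʳ (b * (m * w₂)) (∣n⇒∣m*n a (m∣m*n w₁)) ⟩
    (b * (m * w₂)) % n   ≡⟨ Mod.*-congₘ n {b} refl (proj₂ (Mod.inverseₘ n m⊥n)) ⟩
    (b * 1) % n          ≡⟨ cong (_% n) (*-identityʳ b) ⟩
    b % n                ∎
    where open ≡-Reasoning

prime≡1[4]⇒∤2 : ∀ {p} → Prime p → p % 4 ≡ 1 → p ∤ 2
prime≡1[4]⇒∤2 {1}          p-prime _  _   = ¬prime[1] p-prime
prime≡1[4]⇒∤2 {2}          _       () _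
prime≡1[4]⇒∤2 {suc (suc (suc _))} _ _ p∣2 with ∣⇒≤ p∣2
... | s≤s (s≤s ())

∃∣x²+1-product : ∀ ps → All Prime ps → (∀ q → Prime q → q ∣ product ps → q % 4 ≡ 1) →
  ∃ λ x → product ps ∣ x * x + 1
∃∣x²+1-product []       All.[]                 _              = 0 , ∣-refl
∃∣x²+1-product (p ∷ ps) (p-prime All.∷ ps-prime) all≡1[4]
  with ∃∣x²+1-product ps ps-prime (λ q q-prime q∣∏ps → all≡1[4] q q-prime (∣n⇒∣m*n p q∣∏ps)) | p ∣? product ps
... | b , ∏ps∣b²+1 | yes p∣∏ps = ∣x²+1-lift {a = b} p-prime (prime≡1[4]⇒∤2 p-prime p%4≡1) p∣∏ps ∏ps∣b²+1
  where p%4≡1 = all≡1[4] p p-prime (m∣m*n (product ps))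
... | b , ∏ps∣b²+1 | no p∤∏ps = ∣x²+1-crt {a = proj₁ root} {b = b} {{prime⇒nonZero p-prime}} {{productOfPrimes≢0 ps-prime}}
                                  (⊥-sym (prime-∤⇒coprime p-prime p∤∏ps)) (proj₂ root) ∏ps∣b²+1
  where root = prime≡1[4]⇒∃p∣x²+1 p-prime (all≡1[4] p p-prime (m∣m*n (product ps)))

∃∣x²+1 : ∀ N .{{_ : NonZero N}} → (∀ p → Prime p → p ∣ N → p % 4 ≡ 1) → ∃ λ x → N ∣ x * x + 1
∃∣x²+1 N all≡1[4] = subst (λ n → ∃ λ x → n ∣ x * x + 1) ∏ps≡N
  (∃∣x²+1-product ps (PrimeFactorisation.factorsPrime (factorise N))
    (λ q q-prime q∣∏ps → all≡1[4] q q-prime (subst (q ∣_) ∏ps≡N q∣∏ps)))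
  where
  ps = PrimeFactorisation.factors (factorise N)
  ∏ps≡N : product ps ≡ N
  ∏ps≡N = sym (PrimeFactorisation.isFactorisation (factorise N))

-- Equalities in ℚ are checked through toℚᵘ, where they become identities between integers.
private
  ιᵘ : ℕ → ℚᵘ.ℚᵘ
  ιᵘ n = ℚᵘ.mkℚᵘ (ℤ.+ n) 0

  toℚᵘ-ι : ∀ n → toℚᵘ (ι n) ℚᵘ.≃ ιᵘ n
  toℚᵘ-ι n = toℚᵘ-fromℚᵘ (ιᵘ n)

  3k≡-in-ℤ : ∀ {k n s} → 3 * k ≡ 8 * (n * n) + 1 + 6 * s →
    ℤ.+ 3 ℤ.* ℤ.+ k ≡ ℤ.+ 8 ℤ.* (ℤ.+ n ℤ.* ℤ.+ n) ℤ.+ ℤ.+ 1 ℤ.+ ℤ.+ 6 ℤ.* ℤ.+ s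
  3k≡-in-ℤ {k} {n} {s} 3k≡ = begin
    ℤ.+ 3 ℤ.* ℤ.+ k                                    ≡⟨ ℤ.pos-* 3 k ⟨
    ℤ.+ (3 * k)                                        ≡⟨ cong ℤ.+_ 3k≡ ⟩
    ℤ.+ (8 * (n * n) + 1 + 6 * s)                      ≡⟨ ℤ.pos-+ (8 * (n * n) + 1) (6 * s) ⟩
    ℤ.+ (8 * (n * n) + 1) ℤ.+ ℤ.+ (6 * s)              ≡⟨ cong₂ ℤ._+_ (ℤ.pos-+ (8 * (n * n)) 1) (ℤ.pos-* 6 s) ⟩
    ℤ.+ (8 * (n * n)) ℤ.+ ℤ.+ 1 ℤ.+ ℤ.+ 6 ℤ.* ℤ.+ s    ≡⟨ cong (λ t → t ℤ.+ ℤ.+ 1 ℤ.+ ℤ.+ 6 ℤ.* ℤ.+ s)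
                                                            (trans (ℤ.pos-* 8 (n * n)) (cong (ℤ.+ 8 ℤ.*_) (ℤ.pos-* n n))) ⟩
    ℤ.+ 8 ℤ.* (ℤ.+ n ℤ.* ℤ.+ n) ℤ.+ ℤ.+ 1 ℤ.+ ℤ.+ 6 ℤ.* ℤ.+ s ∎
    where open ≡-Reasoning

  cross-multiplied : ∀ {k n s} → 3 * k ≡ 8 * (n * n) + 1 + 6 * s →
    (ℤ.+ k ℤ.* ℤ.+ 3 ℤ.+ ℤ.- (ℤ.+ 8 ℤ.* (ℤ.+ n ℤ.* ℤ.+ n)) ℤ.* ℤ.+ 1) ℤ.* ℤ.+ 3
      ≡ (ℤ.+ 1 ℤ.* ℤ.+ 1 ℤ.+ (ℤ.+ 2 ℤ.* ℤ.+ s) ℤ.* ℤ.+ 3) ℤ.* ℤ.+ 3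
  cross-multiplied {k} {n} {s} 3k≡ = begin
    (ℤ.+ k ℤ.* ℤ.+ 3 ℤ.+ ℤ.- (ℤ.+ 8 ℤ.* n²) ℤ.* ℤ.+ 1) ℤ.* ℤ.+ 3  ≡⟨ expand (ℤ.+ k) n² ⟩
    (ℤ.+ 3 ℤ.* ℤ.+ k) ℤ.* ℤ.+ 3 ℤ.- ℤ.+ 24 ℤ.* n²               ≡⟨ cong (λ t → t ℤ.* ℤ.+ 3 ℤ.- ℤ.+ 24 ℤ.* n²) (3k≡-in-ℤ {k} {n} {s} 3k≡) ⟩
    (ℤ.+ 8 ℤ.* n² ℤ.+ ℤ.+ 1 ℤ.+ ℤ.+ 6 ℤ.* ℤ.+ s) ℤ.* ℤ.+ 3 ℤ.- ℤ.+ 24 ℤ.* n² ≡⟨ collect n² (ℤ.+ s) ⟩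
    (ℤ.+ 1 ℤ.* ℤ.+ 1 ℤ.+ (ℤ.+ 2 ℤ.* ℤ.+ s) ℤ.* ℤ.+ 3) ℤ.* ℤ.+ 3  ∎
    where
    open ≡-Reasoning
    n² = ℤ.+ n ℤ.* ℤ.+ n
    expand : ∀ K Q → (K ℤ.* ℤ.+ 3 ℤ.+ ℤ.- (ℤ.+ 8 ℤ.* Q) ℤ.* ℤ.+ 1) ℤ.* ℤ.+ 3
                   ≡ (ℤ.+ 3 ℤ.* K) ℤ.* ℤ.+ 3 ℤ.- ℤ.+ 24 ℤ.* Q
    expand = ℤ-solve-∀
    collect : ∀ Q S → (ℤ.+ 8 ℤ.* Q ℤ.+ ℤ.+ 1 ℤ.+ ℤ.+ 6 ℤ.* S) ℤ.* ℤ.+ 3 ℤ.- ℤ.+ 24 ℤ.* Q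
                    ≡ (ℤ.+ 1 ℤ.* ℤ.+ 1 ℤ.+ (ℤ.+ 2 ℤ.* S) ℤ.* ℤ.+ 3) ℤ.* ℤ.+ 3
    collect = ℤ-solve-∀

ι-count-identity : ∀ k n s → 3 * k ≡ 8 * (n * n) + 1 + 6 * s →
  ι k ℚ.- areaP₂ ℚ.* (ι n ℚ.* ι n) ≡ (ℤ.+ 1 ℚ./ 3) ℚ.+ (ι 2 ℚ.* ι s)
ι-count-identity k n s 3k≡ = toℚᵘ-injective (begin
  toℚᵘ (ι k ℚ.- areaP₂ ℚ.* (ι n ℚ.* ι n))           ≈⟨ toℚᵘ-lhs ⟩
  ιᵘ k ℚᵘ.- ℚᵘ.mkℚᵘ (ℤ.+ 8) 2 ℚᵘ.* (ιᵘ n ℚᵘ.* ιᵘ n) ≈⟨ ℚᵘ.*≡* (cross-multiplied {k} {n} {s} 3k≡) ⟩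
  ℚᵘ.mkℚᵘ (ℤ.+ 1) 2 ℚᵘ.+ ιᵘ 2 ℚᵘ.* ιᵘ s             ≈⟨ toℚᵘ-rhs ⟨
  toℚᵘ ((ℤ.+ 1 ℚ./ 3) ℚ.+ (ι 2 ℚ.* ι s))             ∎)
  where
  open ℚᵘ.≃-Reasoning
  8/3n² = areaP₂ ℚ.* (ι n ℚ.* ι n)
  toℚᵘ-lhs : toℚᵘ (ι k ℚ.- 8/3n²) ℚᵘ.≃ ιᵘ k ℚᵘ.- ℚᵘ.mkℚᵘ (ℤ.+ 8) 2 ℚᵘ.* (ιᵘ n ℚᵘ.* ιᵘ n)
  toℚᵘ-lhs = ℚᵘ.≃-trans (toℚᵘ-homo-+ (ι k) (ℚ.- 8/3n²))
    (ℚᵘ.+-cong (toℚᵘ-ι k) (ℚᵘ.≃-trans (toℚᵘ-homo‿- 8/3n²)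
      (ℚᵘ.-‿cong (ℚᵘ.≃-trans (toℚᵘ-homo-* areaP₂ (ι n ℚ.* ι n))
        (ℚᵘ.*-cong (toℚᵘ-fromℚᵘ (ℚᵘ.mkℚᵘ (ℤ.+ 8) 2))
          (ℚᵘ.≃-trans (toℚᵘ-homo-* (ι n) (ι n)) (ℚᵘ.*-cong (toℚᵘ-ι n) (toℚᵘ-ι n))))))))
  toℚᵘ-rhs : toℚᵘ ((ℤ.+ 1 ℚ./ 3) ℚ.+ (ι 2 ℚ.* ι s)) ℚᵘ.≃ ℚᵘ.mkℚᵘ (ℤ.+ 1) 2 ℚᵘ.+ ιᵘ 2 ℚᵘ.* ιᵘ s
  toℚᵘ-rhs = ℚᵘ.≃-trans (toℚᵘ-homo-+ (ℤ.+ 1 ℚ./ 3) (ι 2 ℚ.* ι s))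
    (ℚᵘ.+-cong (toℚᵘ-fromℚᵘ (ℚᵘ.mkℚᵘ (ℤ.+ 1) 2))
      (ℚᵘ.≃-trans (toℚᵘ-homo-* (ι 2) (ι s)) (ℚᵘ.*-cong (toℚᵘ-ι 2) (toℚᵘ-ι s))))

open import Data.Integer using (+_)
open import Data.Rational using (_/_)

corollary1 : (N : ℕ) .{{_ : NonZero N}} →
    (∀ p → Prime p → p ∣ N → p % 4 ≡ 1) →
    (N* : ℕ) → IsGreatestSquareDivisor N N* →
    (s : ℕ) → s ℕ.* s ≡ N* →
    ι (𝒩₂ N) ℚ.- areaP₂ ℚ.* (ι N ℚ.* ι N) ≡ (+ 1 / 3) ℚ.+ (ι 2 ℚ.* ι s)
corollary1 N all≡1[4] N* N*-greatest s s²≡N* =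
  ι-count-identity (𝒩₂ N) N s (3*𝒩₂ N (proj₁ root) (proj₂ root) {s = s} N*-greatest s²≡N*)
  where
  root = ∃∣x²+1 N all≡1[4]
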